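{- Let $\langle S\mid R\rangle$ be a finite presentation whose relations are words $xyz$ of length three with $x,y,z\in S\cup S^{ -1}$, let $G$ be a finite group with a homomorphism $\varphi:G_{S,R}\to G$, set $n=|G|$, fix any field $\mathbb F$, and let $\rho:G\to GL_n(\mathbb F)$ be the regular representation. Let $\mathcal A_{G,\varphi}=\{A_f\}_{f\in E_{S,R}}$ be the subspace arrangement in $\mathbb F^{3n}=\mathbb F^n\oplus\mathbb F^n\oplus\mathbb F^n$ given by: $A_{b^{(i)}}$ is the $i$-th summand; and for each $a\in S\cup S^{ -1}\cup\{e\}$, with $M_a=\rho(\varphi(a))$, $A_{a^{(1)}}$, $A_{a^{(2)}}$, $A_{a^{(3)}}$ are the column spans of the $3n\times n$ block matrices $\begin{bsmallmatrix}-I_n\\ M_a\\ 0\end{bsmallmatrix}$, $\begin{bsmallmatrix}0\\ -I_n\\ M_a\end{bsmallmatrix}$, $\begin{bsmallmatrix}M_a\\ 0\\ -I_n\end{bsmallmatrix}$ respectively. Then $\mathcal A_{G,\varphi}$ is a weak $n$-representation of $N_{S,R}$ with respect to the basis $B=\{b^{(1)},b^{(2)},b^{(3)}\}$.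
   Context: $G_{S,R}=F_S/N$ with $N$ the normal closure of $R$ in the free group $F_S$; here $\varphi(s^{ -1})=\varphi(s)^{ -1}$ and $\varphi(e)$ is the identity, so $M_e=I_n$. The regular representation sends $g$ to the permutation matrix of left multiplication by $g$ on $G$ (basis indexed by $G$). The generalized Dowling geometry $N_{S,R}$: ground set $E_{S,R}$ of distinct symbols $b^{(i)},e^{(i)},s^{(i)},(s^{ -1})^{(i)}$, $i\in\{1,2,3\}$, $s\in S$. It is the rank-3 matroid with basis $B$ whose dependent rank-2 flats are exactly (indices mod 3): $\{e^{(i)},b^{(i)},b^{(i+1)}\}\cup\{s^{(i)},(s^{ -1})^{(i)}:s\in S\}$ for each $i$; $\{s^{(i)},(s^{ -1})^{(j)},e^{(k)}\}$ for $s\in S$, $i,j,k$ pairwise distinct; $\{e^{(1)},e^{(2)},e^{(3)}\}$; and $\{x^{(2)},y^{(1)},z^{(3)}\}$ for each $xyz\in R$. For an arrangement put $A_X=\sum_{f\in X}A_f$, $r^n_{\mathcal A}(X)=\frac1n\dim A_X$. A weak $n$-representation of a matroid $(E,r)$ with respect to a basis $B$ is an arrangement with $\dim A_f=n$ for all $f$, $r^n_{\mathcal A}(X)\le r(X)$ for all $X$, and equality whenever $|X\setminus B|\le1$. -}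

module Defs where

open import Level using (Level; _⊔_; Lift) renaming (suc to lsuc)
open import Algebra.Bundles using (CommutativeRing; Group)
open import Data.Nat using (ℕ; zero; suc; _≤_) renaming (_*_ to _*ℕ_)
open import Data.Fin using (Fin; zero; suc; _≟_)
open import Data.Bool using (Bool; true; false; _∧_; _∨_; not)
open import Data.Bool.ListAction using (any; all)
open import Data.List using (List; []; _∷_; length; map; allFin; concatMap; filterᵇ; _++_)
open import Data.List.Membership.Propositional using (_∈_)
open import Data.List.Relation.Unary.Unique.Propositional using (Unique)
open import Data.Product using (Σ; ∃; ∃₂; _×_; _,_)
open import Relation.Nullary using (¬_; does)
open import Relation.Binary.PropositionalEquality using (_≡_)
import Relation.Binary.PropositionalEquality as ≡
open import Function.Bundles using (Inverse)

record Field (c ℓ : Level) : Set (lsuc (c ⊔ ℓ)) where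
  field
    commutativeRing : CommutativeRing c ℓ
  open CommutativeRing commutativeRing public
  field
    0≉1     : ¬ (0# ≈ 1#)
    inverse : ∀ x → ¬ (x ≈ 0#) → Σ Carrier λ y → x * y ≈ 1#

data Letter (m : ℕ) : Set where
  gen : Fin m → Letter m
  inv : Fin m → Letter m

Relator : ℕ → Set
Relator m = Letter m × Letter m × Letter m

-- A homomorphism φ : G_{S,R} → G, given (universal property of the
-- presented group G_{S,R} = F_S / N) by the images of the generators,
-- subject to every relator being sent to the identity.
module _ {g ℓg : Level} (G : Group g ℓg) where
  open Group G

  letterVal : ∀ {m} → (Fin m → Carrier) → Letter m → Carrier
  letterVal φ (gen s) = φ s
  letterVal φ (inv s) = φ s ⁻¹

  record PresHom (m : ℕ) (R : List (Relator m)) : Set (g ⊔ ℓg) where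
    field
      gens     : Fin m → Carrier
      respects : ∀ {x y z} → (x , y , z) ∈ R →
                 (letterVal gens x ∙ letterVal gens y) ∙ letterVal gens z ≈ ε

-- Ground set E_{S,R}:  symbols b, e, s, s⁻¹ with superscript i ∈ {1,2,3};
-- superscript i is encoded by the element i-1 of Fin 3.

data Sym (m : ℕ) : Set where
  bS : Sym m
  eS : Sym m
  lS : Letter m → Sym m

Elt : ℕ → Set
Elt m = Fin 3 × Sym m

isB : ∀ {m} → Elt m → Bool
isB (_ , bS) = true
isB (_ , eS) = false
isB (_ , lS _) = false

eqFin : ∀ {k} → Fin k → Fin k → Bool
eqFin i j = does (i ≟ j)

eqLetter : ∀ {m} → Letter m → Letter m → Bool
eqLetter (gen s) (gen t) = eqFin s t
eqLetter (inv s) (inv t) = eqFin s t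
eqLetter _ _ = false

eqSym : ∀ {m} → Sym m → Sym m → Bool
eqSym bS bS = true
eqSym eS eS = true
eqSym (lS x) (lS y) = eqLetter x y
eqSym _ _ = false

suc3 : Fin 3 → Fin 3
suc3 zero = suc zero
suc3 (suc zero) = suc (suc zero)
suc3 (suc (suc zero)) = zero

f1 f2 f3 : Fin 3
f1 = zero
f2 = suc zero
f3 = suc (suc zero)

-- The dependent rank-2 flats (lines) of N_{S,R}.
data Line (m : ℕ) : Set where
  L1 : Fin 3 → Line m
  L2 : Fin m → Fin 3 → Fin 3 → Fin 3 → Line m
  L3 : Line m
  L4 : Relator m → Line m

onLine : ∀ {m} → Elt m → Line m → Bool
onLine (i' , bS)   (L1 i) = eqFin i' i ∨ eqFin i' (suc3 i)
onLine (i' , eS)   (L1 i) = eqFin i' i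
onLine (i' , lS _) (L1 i) = eqFin i' i
onLine (i' , σ) (L2 s i j k) =
  (eqFin i' i ∧ eqSym σ (lS (gen s))) ∨
  ((eqFin i' j ∧ eqSym σ (lS (inv s))) ∨ (eqFin i' k ∧ eqSym σ eS))
onLine (_ , σ) L3 = eqSym σ eS
onLine (i' , σ) (L4 (x , y , z)) =
  (eqFin i' f2 ∧ eqSym σ (lS x)) ∨
  ((eqFin i' f1 ∧ eqSym σ (lS y)) ∨ (eqFin i' f3 ∧ eqSym σ (lS z)))

distinct3 : Fin 3 → Fin 3 → Fin 3 → Bool
distinct3 i j k = not (eqFin i j) ∧ (not (eqFin i k) ∧ not (eqFin j k))

allLines : (m : ℕ) → List (Relator m) → List (Line m)
allLines m R =
  map L1 (allFin 3) ++
  (concatMap (λ s → concatMap (λ i → concatMap (λ j →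
     map (L2 s i j) (filterᵇ (distinct3 i j) (allFin 3)))
     (allFin 3)) (allFin 3)) (allFin m) ++
  (L3 ∷ map L4 R))

-- Rank function of the simple rank-3 matroid N_{S,R} on a set X
-- (given as a duplicate-free list): |X| if |X| ≤ 2; otherwise 2 if X
-- lies in one of the dependent lines, and 3 if not.
rankN : (m : ℕ) → List (Relator m) → List (Elt m) → ℕ
rankN m R [] = 0
rankN m R (_ ∷ []) = 1
rankN m R (_ ∷ _ ∷ []) = 2
rankN m R X@(_ ∷ _ ∷ _ ∷ _) with any (λ L → all (λ f → onLine f L) X) (allLines m R)
... | true  = 2
... | false = 3

module LinAlg {c ℓ : Level} (F : Field c ℓ) (n : ℕ) where
  open Field F using (Carrier; _≈_; _+_; _*_; -_; 0#; 1#)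

  V : Set c
  V = Fin 3 → Fin n → Carrier

  Subspace : Set (lsuc (c ⊔ ℓ))
  Subspace = V → Set (c ⊔ ℓ)

  ∑ : ∀ {k} → (Fin k → Carrier) → Carrier
  ∑ {zero} f = 0#
  ∑ {suc k} f = f zero + ∑ (λ i → f (suc i))

  InSpan : ∀ {k} → (Fin k → V) → V → Set (c ⊔ ℓ)
  InSpan v w = ∃ λ (a : Fin _ → Carrier) → ∀ p r → w p r ≈ ∑ (λ l → a l * v l p r)

  Independent : ∀ {k} → (Fin k → V) → Set (c ⊔ ℓ)
  Independent v = ∀ (a : Fin _ → Carrier) →
    (∀ p r → ∑ (λ l → a l * v l p r) ≈ 0#) → ∀ l → a l ≈ 0#

  IsDim : Subspace → ℕ → Set (c ⊔ ℓ)
  IsDim W d = ∃ λ (v : Fin d → V) →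
    (∀ l → W (v l)) × Independent v × (∀ w → W w → InSpan v w)

  SumSp : List Subspace → Subspace
  SumSp [] w = Lift c (∀ p r → w p r ≈ 0#)
  SumSp (A ∷ As) w = ∃₂ λ u v → A u × SumSp As v × (∀ p r → w p r ≈ u p r + v p r)

  Summand : Fin 3 → Subspace
  Summand i w = ∃ λ (u : Fin n → Carrier) →
    ∀ p r → w p r ≈ (if does (p ≟ i) then u r else 0#)
    where open import Data.Bool using (if_then_else_)

  ColSpan : (Fin n → V) → Subspace
  ColSpan = InSpan

  δ : Fin n → Fin n → Carrier
  δ r j = if does (r ≟ j) then 1# else 0#
    where open import Data.Bool using (if_then_else_)

  blockCol : Fin 3 → (Fin n → Fin n → Carrier) → Fin n → V
  blockCol zero M j zero r = - δ r j
  blockCol zero M j (suc zero) r = M r j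
  blockCol zero M j (suc (suc zero)) r = 0#
  blockCol (suc zero) M j zero r = 0#
  blockCol (suc zero) M j (suc zero) r = - δ r j
  blockCol (suc zero) M j (suc (suc zero)) r = M r j
  blockCol (suc (suc zero)) M j zero r = M r j
  blockCol (suc (suc zero)) M j (suc zero) r = 0#
  blockCol (suc (suc zero)) M j (suc (suc zero)) r = - δ r j

  -- weak n-representation of a matroid (E , r) w.r.t. the basis given by isBasis
  -- (subsets X ⊆ E are duplicate-free lists; r^n(X) ≤ r(X) is written
  -- dim A_X ≤ n · r(X), and |X ∖ B| ≤ 1 counts the non-basis elements of X)
  WeakRep : {E : Set} → (List E → ℕ) → (E → Bool) → (E → Subspace) → Set (c ⊔ ℓ)
  WeakRep {E} r isBasis A =
    (∀ f → IsDim (A f) n) ×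
    (∀ (X : List E) → Unique X →
      ∃ λ d → IsDim (SumSp (map A X)) d × d ≤ n *ℕ r X ×
        (length (filterᵇ (λ f → not (isBasis f)) X) ≤ 1 → d ≡ n *ℕ r X))

module _ {c ℓ g ℓg : Level} (F : Field c ℓ) (G : Group g ℓg) (n : ℕ)
         (enum : Inverse (Group.setoid G) (≡.setoid (Fin n))) where
  open Field F using (0#; 1#) renaming (Carrier to K)
  open Group G using (_∙_; ε) renaming (Carrier to Gc)
  open Inverse enum using (to; from)
  open LinAlg F n
  open import Data.Bool using (if_then_else_)

  -- ρ(g): permutation matrix of h ↦ g h on the basis {from j} ≅ G
  regRep : Gc → Fin n → Fin n → K
  regRep x i j = if does (to (x ∙ from j) ≟ i) then 1# else 0#

  arrangement : ∀ {m R} → PresHom G m R → Elt m → Subspace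
  arrangement φ (i , bS)   = Summand i
  arrangement φ (i , eS)   = ColSpan (blockCol i (regRep ε))
  arrangement φ (i , lS a) = ColSpan (blockCol i (regRep (letterVal G (PresHom.gens φ) a)))

module Submission where

-- Every column of the block matrices is a unit vector e_v (for b⁽ⁱ⁾) or a difference e_v − e_u
-- with u = (i , x) and v = (i + 1 , φ(a) x) (for a⁽ⁱ⁾), so A_X is spanned by the edges of a graph
-- on the 3n vertices {1,2,3} × G in which some vertices are grounded. A union–find labelling of
-- these edges yields a basis of A_X indexed by the vertices that are not class representatives,
-- so dim A_X = 3n − #roots. Lower bounds on #roots come from vertex labellings that are constant
-- along arcs: on a dependent line of N_{S,R} the group labels close up around the triangle of
-- blocks (for {x⁽²⁾, y⁽¹⁾, z⁽³⁾} because xyz = 1 in G), so n vertices remain separate roots.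
-- Lower bounds on dim A_X come from the blocks grounded by b-elements, propagated along arcs.

open import Defs
open import Level using (Level; _⊔_; lift)
open import Algebra.Bundles using (Group)
open import Function using (id; _∘_; _∋_)
open import Function.Bundles using (Inverse; Equivalence; mk⇔)
open import Data.Nat using (ℕ; zero; suc; _≤_; z≤n; s≤s) renaming (_+_ to _+ℕ_; _*_ to _*ℕ_)
import Data.Nat.Properties as ℕₚ
open import Data.Fin using (Fin; zero; suc; _≟_)
open import Data.Bool using (Bool; true; false; if_then_else_; _∧_; _∨_; not)
open import Data.Bool.Properties using (T-≡; ∨-zeroʳ; not-involutive)
open import Data.Bool.ListAction using (any; all)
open import Data.Maybe using (Maybe; just; nothing; fromMaybe)
import Data.Maybe.Properties as Maybeₚ
import Data.Product.Properties as Productₚ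
open import Data.List using (List; []; _∷_; _++_; map; length; tabulate; lookup; allFin; concatMap; filterᵇ; foldr)
open import Data.List.Properties
  using (length-map; length-++; length-tabulate; length-filter; map-tabulate; map-++; ++-identityʳ)
open import Data.List.Membership.Propositional using (_∈_; _∉_; find; lose)
open import Data.List.Membership.Propositional.Properties
  using ( ∈-filter⁺; ∈-filter⁻; ∈-map⁺; ∈-map⁻; ∈-++⁺ˡ; ∈-++⁺ʳ; ∈-++⁻; ∈-concatMap⁻
        ; ∈-tabulate⁺; ∈-tabulate⁻; ∈-allFin; ∈-lookup)
open import Data.List.Membership.DecPropositional (_≟_ {3}) using (_∈?_)
open import Data.List.Relation.Unary.Any using (here; there; satisfied; any?)
open import Data.List.Relation.Unary.Any.Properties using (any⁺; any⁻)
import Data.List.Relation.Unary.All as All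
open import Data.List.Relation.Unary.All.Properties using (all⁺; all⁻)
open import Data.List.Relation.Unary.AllPairs using ([]; _∷_)
open import Data.List.Relation.Unary.Unique.Propositional using (Unique)
import Data.List.Relation.Unary.Unique.Propositional.Properties as Uniqueₚ
open import Data.Product using (∃; ∃₂; _×_; _,_; proj₁; proj₂)
open import Data.Sum using (_⊎_; inj₁; inj₂; [_,_]′)
open import Data.Empty using (⊥-elim)
open import Data.Unit using (⊤; tt)
open import Relation.Nullary using (Dec; does; yes; no)
open import Relation.Nullary.Decidable using (dec-true; dec-false; does-⇔; T?; map′)
open import Relation.Binary.Definitions using (DecidableEquality)
open import Relation.Binary.PropositionalEquality as ≡ using (_≡_; _≢_; setoid)

does-sound : ∀ {p} {P : Set p} (p? : Dec P) → does p? ≡ true → P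
does-sound (yes p) _ = p

true≢false : ∀ {b : Bool} → b ≡ true → b ≢ false
true≢false ≡.refl ()

module _ {a} {A : Set a} where

  ∈-filterᵇ⁺ : ∀ (P : A → Bool) {x xs} → x ∈ xs → P x ≡ true → x ∈ filterᵇ P xs
  ∈-filterᵇ⁺ P x∈xs Px = ∈-filter⁺ (T? ∘ P) x∈xs (Equivalence.from T-≡ Px)

  ∈-filterᵇ⁻ : ∀ (P : A → Bool) {x xs} → x ∈ filterᵇ P xs → x ∈ xs × P x ≡ true
  ∈-filterᵇ⁻ P x∈ with ∈-filter⁻ (T? ∘ P) x∈
  ... | x∈xs , Px = x∈xs , Equivalence.to T-≡ Px

  length-filterᵇ-not : ∀ (P : A → Bool) xs →
    length (filterᵇ P xs) +ℕ length (filterᵇ (not ∘ P) xs) ≡ length xs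
  length-filterᵇ-not P [] = ≡.refl
  length-filterᵇ-not P (x ∷ xs) with P x
  ... | true = ≡.cong suc (length-filterᵇ-not P xs)
  ... | false = ≡.trans (ℕₚ.+-suc _ _) (≡.cong suc (length-filterᵇ-not P xs))

  private
    remove : ∀ {x : A} xs → x ∈ xs → List A
    remove (_ ∷ xs) (here _) = xs
    remove (y ∷ xs) (there x∈xs) = y ∷ remove xs x∈xs

    length-remove : ∀ {x : A} xs (x∈xs : x ∈ xs) → length xs ≡ suc (length (remove xs x∈xs))
    length-remove (_ ∷ xs) (here _) = ≡.refl
    length-remove (_ ∷ xs) (there x∈xs) = ≡.cong suc (length-remove xs x∈xs)

    ∈-remove : ∀ {x z : A} xs (x∈xs : x ∈ xs) → z ∈ xs → z ≢ x → z ∈ remove xs x∈xs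
    ∈-remove (_ ∷ xs) (here ≡.refl) (here ≡.refl) z≢x = ⊥-elim (z≢x ≡.refl)
    ∈-remove (_ ∷ xs) (here ≡.refl) (there z∈xs) _ = z∈xs
    ∈-remove (_ ∷ xs) (there _) (here ≡.refl) _ = here ≡.refl
    ∈-remove (_ ∷ xs) (there x∈xs) (there z∈xs) z≢x = there (∈-remove xs x∈xs z∈xs z≢x)

  length-≤-⊆ : ∀ {xs ys : List A} → Unique xs → (∀ {x} → x ∈ xs → x ∈ ys) → length xs ≤ length ys
  length-≤-⊆ {xs = []} _ _ = z≤n
  length-≤-⊆ {xs = x ∷ xs} {ys} (x∉xs ∷ u) xs⊆ys =
    ≡.subst (suc (length xs) ≤_) (≡.sym (length-remove ys x∈ys))
      (s≤s (length-≤-⊆ u λ z∈xs → ∈-remove ys x∈ys (xs⊆ys (there z∈xs))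
                                     λ { ≡.refl → All.lookup x∉xs z∈xs ≡.refl }))
    where x∈ys = xs⊆ys (here ≡.refl)

  length≤1-≡ : ∀ {xs : List A} → length xs ≤ 1 → ∀ {x y} → x ∈ xs → y ∈ xs → x ≡ y
  length≤1-≡ {xs = _ ∷ []} _ (here ≡.refl) (here ≡.refl) = ≡.refl
  length≤1-≡ {xs = _ ∷ _ ∷ _} (s≤s ())

  lookup-injective : ∀ {xs : List A} → Unique xs → ∀ {i j} → lookup xs i ≡ lookup xs j → i ≡ j
  lookup-injective {xs = x ∷ xs} _ {zero} {zero} _ = ≡.refl
  lookup-injective {xs = x ∷ xs} (x∉ ∷ _) {zero} {suc j} e = ⊥-elim (All.lookup x∉ (∈-lookup j) e)
  lookup-injective {xs = x ∷ xs} (x∉ ∷ _) {suc i} {zero} e = ⊥-elim (All.lookup x∉ (∈-lookup i) (≡.sym e))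
  lookup-injective {xs = x ∷ xs} (_ ∷ u) {suc i} {suc j} e = ≡.cong suc (lookup-injective u e)

length-≤-injection : ∀ {a b} {A : Set a} {B : Set b} (f : A → B) {xs : List A} {ys : List B} → Unique xs →
  (∀ {x y} → x ∈ xs → y ∈ xs → f x ≡ f y → x ≡ y) → (∀ {x} → x ∈ xs → f x ∈ ys) →
  length xs ≤ length ys
length-≤-injection f {xs} u inj maps = ≡.subst (_≤ _) (length-map f xs)
  (length-≤-⊆ (unique-map u inj) λ fx∈ →
    let (x , x∈xs , fx≡) = ∈-map⁻ f fx∈ in ≡.subst (_∈ _) (≡.sym fx≡) (maps x∈xs))
  where
  unique-map : ∀ {xs} → Unique xs → (∀ {x y} → x ∈ xs → y ∈ xs → f x ≡ f y → x ≡ y) → Unique (map f xs)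
  unique-map [] _ = []
  unique-map (x∉xs ∷ u) inj =
    All.tabulate (λ fy∈ fx≡fy → let (y , y∈xs , fy≡) = ∈-map⁻ f fy∈ in
                    All.lookup x∉xs y∈xs (inj (here ≡.refl) (there y∈xs) (≡.trans fx≡fy fy≡)))
    ∷ unique-map u (λ x∈ y∈ → inj (there x∈) (there y∈))

eqFin-refl : ∀ {k} (i : Fin k) → eqFin i i ≡ true
eqFin-refl i = dec-true (i ≟ i) ≡.refl

eqFin-sound : ∀ {k} {i j : Fin k} → eqFin i j ≡ true → i ≡ j
eqFin-sound {i = i} {j} = does-sound (i ≟ j)

eqFin-sym : ∀ {k} (i j : Fin k) → eqFin i j ≡ eqFin j i
eqFin-sym i j = does-⇔ (mk⇔ ≡.sym ≡.sym) (i ≟ j) (j ≟ i)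

eqLetter-sound : ∀ {m} (x y : Letter m) → eqLetter x y ≡ true → x ≡ y
eqLetter-sound (gen s) (gen t) e = ≡.cong gen (eqFin-sound e)
eqLetter-sound (inv s) (inv t) e = ≡.cong inv (eqFin-sound e)

eqSym-sound : ∀ {m} (σ τ : Sym m) → eqSym σ τ ≡ true → σ ≡ τ
eqSym-sound bS bS _ = ≡.refl
eqSym-sound eS eS _ = ≡.refl
eqSym-sound (lS x) (lS y) e = ≡.cong lS (eqLetter-sound x y e)

suc3-≢ : ∀ i → i ≢ suc3 i
suc3-≢ zero ()
suc3-≢ (suc zero) ()
suc3-≢ (suc (suc zero)) ()

suc3²-≢ : ∀ i → i ≢ suc3 (suc3 i)
suc3²-≢ zero ()
suc3²-≢ (suc zero) ()
suc3²-≢ (suc (suc zero)) ()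

suc3³ : ∀ i → suc3 (suc3 (suc3 i)) ≡ i
suc3³ zero = ≡.refl
suc3³ (suc zero) = ≡.refl
suc3³ (suc (suc zero)) = ≡.refl

rotation-cases : ∀ i p → p ≡ i ⊎ p ≡ suc3 i ⊎ p ≡ suc3 (suc3 i)
rotation-cases zero zero = inj₁ ≡.refl
rotation-cases zero (suc zero) = inj₂ (inj₁ ≡.refl)
rotation-cases zero (suc (suc zero)) = inj₂ (inj₂ ≡.refl)
rotation-cases (suc zero) zero = inj₂ (inj₂ ≡.refl)
rotation-cases (suc zero) (suc zero) = inj₁ ≡.refl
rotation-cases (suc zero) (suc (suc zero)) = inj₂ (inj₁ ≡.refl)
rotation-cases (suc (suc zero)) zero = inj₂ (inj₁ ≡.refl)
rotation-cases (suc (suc zero)) (suc zero) = inj₂ (inj₂ ≡.refl)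
rotation-cases (suc (suc zero)) (suc (suc zero)) = inj₁ ≡.refl

distinct-cases : ∀ {a b c : Fin 3} → a ≢ b → a ≢ c → b ≢ c → ∀ q → q ≡ a ⊎ q ≡ b ⊎ q ≡ c
distinct-cases {a} {b} {c} a≢b a≢c b≢c q with rotation-cases a b | rotation-cases a c | rotation-cases a q
... | inj₁ e | _ | _ = ⊥-elim (a≢b (≡.sym e))
... | _ | inj₁ e | _ = ⊥-elim (a≢c (≡.sym e))
... | _ | _ | inj₁ e = inj₁ e
... | inj₂ (inj₁ b₁) | inj₂ (inj₁ c₁) | _ = ⊥-elim (b≢c (≡.trans b₁ (≡.sym c₁)))
... | inj₂ (inj₂ b₂) | inj₂ (inj₂ c₂) | _ = ⊥-elim (b≢c (≡.trans b₂ (≡.sym c₂)))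
... | inj₂ (inj₁ b₁) | inj₂ (inj₂ _) | inj₂ (inj₁ q₁) = inj₂ (inj₁ (≡.trans q₁ (≡.sym b₁)))
... | inj₂ (inj₁ _) | inj₂ (inj₂ c₂) | inj₂ (inj₂ q₂) = inj₂ (inj₂ (≡.trans q₂ (≡.sym c₂)))
... | inj₂ (inj₂ _) | inj₂ (inj₁ c₁) | inj₂ (inj₁ q₁) = inj₂ (inj₂ (≡.trans q₁ (≡.sym c₁)))
... | inj₂ (inj₂ b₂) | inj₂ (inj₁ _) | inj₂ (inj₂ q₂) = inj₂ (inj₁ (≡.trans q₂ (≡.sym b₂)))

module _ {a} {A : Set a} where

  rot : Fin 3 → A → A → A → Fin 3 → A
  rot zero x y z zero = x
  rot zero x y z (suc zero) = y
  rot zero x y z (suc (suc zero)) = z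
  rot (suc zero) x y z zero = z
  rot (suc zero) x y z (suc zero) = x
  rot (suc zero) x y z (suc (suc zero)) = y
  rot (suc (suc zero)) x y z zero = y
  rot (suc (suc zero)) x y z (suc zero) = z
  rot (suc (suc zero)) x y z (suc (suc zero)) = x

  rot-0 : ∀ i (x y z : A) → rot i x y z i ≡ x
  rot-0 zero x y z = ≡.refl
  rot-0 (suc zero) x y z = ≡.refl
  rot-0 (suc (suc zero)) x y z = ≡.refl

  rot-1 : ∀ i (x y z : A) → rot i x y z (suc3 i) ≡ y
  rot-1 zero x y z = ≡.refl
  rot-1 (suc zero) x y z = ≡.refl
  rot-1 (suc (suc zero)) x y z = ≡.refl

  rot-2 : ∀ i (x y z : A) → rot i x y z (suc3 (suc3 i)) ≡ z
  rot-2 zero x y z = ≡.refl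
  rot-2 (suc zero) x y z = ≡.refl
  rot-2 (suc (suc zero)) x y z = ≡.refl

∨-true : ∀ {a b} → a ∨ b ≡ true → a ≡ true ⊎ b ≡ true
∨-true {true} _ = inj₁ ≡.refl
∨-true {false} b≡true = inj₂ b≡true

∧-true : ∀ {a b} → a ∧ b ≡ true → a ≡ true × b ≡ true
∧-true {true} b≡true = ≡.refl , b≡true

distinct3-sound : ∀ {i j k} → distinct3 i j k ≡ true → i ≢ j × i ≢ k × j ≢ k
distinct3-sound d with ∧-true d
... | i≢j , rest with ∧-true rest
...   | i≢k , j≢k = not-eqFin i≢j , not-eqFin i≢k , not-eqFin j≢k
  where
  not-eqFin : ∀ {a b : Fin 3} → not (eqFin a b) ≡ true → a ≢ b
  not-eqFin {a} ne ≡.refl rewrite eqFin-refl a with () ← ne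

module _ {m : ℕ} where

  OnTriple : Elt m → (Fin 3 × Sym m) → (Fin 3 × Sym m) → (Fin 3 × Sym m) → Set
  OnTriple f u v w = f ≡ u ⊎ f ≡ v ⊎ f ≡ w

  private
    decode : ∀ {p : Fin 3} {σ : Sym m} a α → (eqFin p a ∧ eqSym σ α) ≡ true → (p , σ) ≡ (a , α)
    decode {σ = σ} a α e with ∧-true e
    ... | p≡a , σ≡α = ≡.cong₂ _,_ (eqFin-sound p≡a) (eqSym-sound σ α σ≡α)

    decode3 : ∀ {p : Fin 3} {σ : Sym m} a α b β c γ →
      ((eqFin p a ∧ eqSym σ α) ∨ ((eqFin p b ∧ eqSym σ β) ∨ (eqFin p c ∧ eqSym σ γ))) ≡ true →
      OnTriple (p , σ) (a , α) (b , β) (c , γ)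
    decode3 a α b β c γ e with ∨-true e
    ... | inj₁ e₁ = inj₁ (decode a α e₁)
    ... | inj₂ e₂ with ∨-true e₂
    ...   | inj₁ e₃ = inj₂ (inj₁ (decode b β e₃))
    ...   | inj₂ e₄ = inj₂ (inj₂ (decode c γ e₄))

  onL2 : ∀ f {s i j k} → onLine f (L2 s i j k) ≡ true →
    OnTriple f (i , lS (gen s)) (j , lS (inv s)) (k , eS)
  onL2 (p , bS) = decode3 _ _ _ _ _ _
  onL2 (p , eS) = decode3 _ _ _ _ _ _
  onL2 (p , lS _) = decode3 _ _ _ _ _ _

  onL3 : ∀ (f : Elt m) → onLine f L3 ≡ true → proj₂ f ≡ eS
  onL3 (p , eS) _ = ≡.refl

  onL4 : ∀ f {x y z} → onLine f (L4 (x , y , z)) ≡ true →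
    OnTriple f (f2 , lS x) (f1 , lS y) (f3 , lS z)
  onL4 (p , bS) = decode3 _ _ _ _ _ _
  onL4 (p , eS) = decode3 _ _ _ _ _ _
  onL4 (p , lS _) = decode3 _ _ _ _ _ _

  ValidLine : List (Relator m) → Line m → Set
  ValidLine R (L1 _) = ⊤
  ValidLine R (L2 _ i j k) = distinct3 i j k ≡ true
  ValidLine R L3 = ⊤
  ValidLine R (L4 r) = r ∈ R

  private
    L2s-at : Fin m → Fin 3 → List (Line m)
    L2s-at s i = concatMap (λ j → map (L2 s i j) (filterᵇ (distinct3 i j) (allFin 3))) (allFin 3)

    L2s : List (Line m)
    L2s = concatMap (λ s → concatMap (L2s-at s) (allFin 3)) (allFin m)

  allLines-valid : ∀ {R L} → L ∈ allLines m R → ValidLine R L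
  allLines-valid {R} L∈ with ∈-++⁻ (map L1 (allFin 3)) L∈
  ... | inj₁ L∈L1s with ∈-map⁻ L1 L∈L1s
  ...   | _ , _ , ≡.refl = tt
  allLines-valid {R} L∈ | inj₂ L∈′ with ∈-++⁻ L2s L∈′
  ... | inj₂ (here ≡.refl) = tt
  ... | inj₂ (there L∈L4s) with ∈-map⁻ L4 L∈L4s
  ...   | _ , r∈R , ≡.refl = r∈R
  allLines-valid {R} L∈ | inj₂ L∈′ | inj₁ L∈L2s
    with s , L∈s ← satisfied (∈-concatMap⁻ (λ s → concatMap (L2s-at s) (allFin 3)) {xs = allFin m} L∈L2s)
    with i , L∈i ← satisfied (∈-concatMap⁻ (L2s-at s) {xs = allFin 3} L∈s)
    with j , L∈j ← satisfied (∈-concatMap⁻ (λ j → map (L2 s i j) (filterᵇ (distinct3 i j) (allFin 3)))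
                                           {xs = allFin 3} L∈i)
    with k , k∈ , ≡.refl ← ∈-map⁻ (L2 s i j) L∈j
    = Equivalence.to T-≡ (proj₂ (∈-filter⁻ (T? ∘ distinct3 i j) {xs = allFin 3} k∈))

module Spans {c ℓ : Level} (F : Field c ℓ) (n : ℕ) where
  open Field F hiding (zero; setoid)
  open LinAlg F n public
  open import Algebra.Properties.Ring ring using (-1*x≈-x)
  open import Algebra.Properties.CommutativeSemigroup +-commutativeSemigroup using (interchange)
  open import Relation.Binary.Reasoning.Setoid (Field.setoid F)

  infix 4 _≐_
  infixr 6 _⊕_
  infixr 7 _⊙_

  _≐_ : V → V → Set ℓ
  u ≐ v = ∀ p r → u p r ≈ v p r

  _⊕_ : V → V → V
  (u ⊕ v) p r = u p r + v p r

  _⊙_ : Carrier → V → V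
  (a ⊙ u) p r = a * u p r

  ⊖_ : V → V
  (⊖ u) p r = - u p r

  𝟘 : V
  𝟘 p r = 0#

  data Span : List V → V → Set (c ⊔ ℓ) where
    span[] : ∀ {w} → w ≐ 𝟘 → Span [] w
    span∷ : ∀ {g gs w} (a : Carrier) (u : V) → Span gs u → w ≐ a ⊙ g ⊕ u → Span (g ∷ gs) w

  Span-resp : ∀ {gs w w'} → Span gs w → w ≐ w' → Span gs w'
  Span-resp (span[] e) w≐w' = span[] λ p r → trans (sym (w≐w' p r)) (e p r)
  Span-resp (span∷ a u s e) w≐w' = span∷ a u s λ p r → trans (sym (w≐w' p r)) (e p r)

  Span-𝟘 : ∀ gs → Span gs 𝟘
  Span-𝟘 [] = span[] λ p r → refl
  Span-𝟘 (g ∷ gs) = span∷ 0# 𝟘 (Span-𝟘 gs) λ p r → sym (trans (+-identityʳ _) (zeroˡ _))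

  Span-⊕ : ∀ {gs u v} → Span gs u → Span gs v → Span gs (u ⊕ v)
  Span-⊕ (span[] e) (span[] f) = span[] λ p r → trans (+-cong (e p r) (f p r)) (+-identityʳ 0#)
  Span-⊕ {g ∷ _} {u} {v} (span∷ a u' s e) (span∷ b v' t f) =
    span∷ (a + b) (u' ⊕ v') (Span-⊕ s t) λ p r → begin
      u p r + v p r                                ≈⟨ +-cong (e p r) (f p r) ⟩
      (a * g p r + u' p r) + (b * g p r + v' p r)  ≈⟨ interchange _ _ _ _ ⟩
      (a * g p r + b * g p r) + (u' p r + v' p r)  ≈⟨ +-cong (distribʳ _ _ _) refl ⟨
      (a + b) * g p r + (u' p r + v' p r)          ∎

  Span-⊙ : ∀ {gs u} b → Span gs u → Span gs (b ⊙ u)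
  Span-⊙ b (span[] e) = span[] λ p r → trans (*-cong refl (e p r)) (zeroʳ b)
  Span-⊙ {g ∷ _} {u} b (span∷ a u' s e) = span∷ (b * a) (b ⊙ u') (Span-⊙ b s) λ p r → begin
      b * u p r                   ≈⟨ *-cong refl (e p r) ⟩
      b * (a * g p r + u' p r)    ≈⟨ distribˡ _ _ _ ⟩
      b * (a * g p r) + b * u' p r ≈⟨ +-cong (*-assoc _ _ _) refl ⟨
      (b * a) * g p r + b * u' p r ∎

  Span-⊖ : ∀ {gs u} → Span gs u → Span gs (⊖ u)
  Span-⊖ s = Span-resp (Span-⊙ (- 1#) s) λ p r → -1*x≈-x _

  Span-there : ∀ {g gs w} → Span gs w → Span (g ∷ gs) w
  Span-there {w = w} s = span∷ 0# w s λ p r → sym (trans (+-cong (zeroˡ _) refl) (+-identityˡ _))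

  Span-here : ∀ {g gs} → Span (g ∷ gs) g
  Span-here {gs = gs} = span∷ 1# 𝟘 (Span-𝟘 gs) λ p r → sym (trans (+-identityʳ _) (*-identityˡ _))

  Span-++ˡ : ∀ {gs} hs {w} → Span gs w → Span (gs ++ hs) w
  Span-++ˡ hs (span[] e) = Span-resp (Span-𝟘 hs) λ p r → sym (e p r)
  Span-++ˡ hs (span∷ a u s e) = span∷ a u (Span-++ˡ hs s) e

  Span-++ʳ : ∀ gs {hs w} → Span hs w → Span (gs ++ hs) w
  Span-++ʳ [] s = s
  Span-++ʳ (g ∷ gs) s = Span-there (Span-++ʳ gs s)

  Span-++⁻ : ∀ gs {hs w} → Span (gs ++ hs) w → ∃₂ λ u v → Span gs u × Span hs v × w ≐ u ⊕ v
  Span-++⁻ [] {w = w} s = 𝟘 , w , Span-𝟘 [] , s , λ p r → sym (+-identityˡ _)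
  Span-++⁻ (g ∷ gs) (span∷ a u s e) with Span-++⁻ gs s
  ... | u₁ , v₁ , s₁ , t₁ , e₁ = a ⊙ g ⊕ u₁ , v₁ , span∷ a u₁ s₁ (λ p r → refl) , t₁ ,
          λ p r → trans (e p r) (trans (+-cong refl (e₁ p r)) (sym (+-assoc _ _ _)))

  InSpan⇒Span : ∀ {k} (v : Fin k → V) {w} → InSpan v w → Span (tabulate v) w
  InSpan⇒Span {zero} v (a , e) = span[] e
  InSpan⇒Span {suc k} v (a , e) =
    span∷ (a zero) _ (InSpan⇒Span (λ l → v (suc l)) ((λ l → a (suc l)) , λ p r → refl)) e

  Span⇒InSpan : ∀ {k} (v : Fin k → V) {w} → Span (tabulate v) w → InSpan v w
  Span⇒InSpan {zero} v (span[] e) = (λ ()) , e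
  Span⇒InSpan {suc k} v (span∷ a u s e) with Span⇒InSpan (λ l → v (suc l)) s
  ... | b , f = (λ { zero → a ; (suc l) → b l }) , λ p r → trans (e p r) (+-cong refl (f p r))

  ∑-cong : ∀ {k} {f g : Fin k → Carrier} → (∀ i → f i ≈ g i) → ∑ f ≈ ∑ g
  ∑-cong {zero} _ = refl
  ∑-cong {suc k} f≈g = +-cong (f≈g zero) (∑-cong (λ i → f≈g (suc i)))

  ∑-0 : ∀ {k} {f : Fin k → Carrier} → (∀ i → f i ≈ 0#) → ∑ f ≈ 0#
  ∑-0 {zero} _ = refl
  ∑-0 {suc k} f≈0 = trans (+-cong (f≈0 zero) (∑-0 (λ i → f≈0 (suc i)))) (+-identityʳ 0#)

  InSpan-cong : ∀ {k} {v v' : Fin k → V} → (∀ l → v l ≐ v' l) → ∀ {w} → InSpan v w → InSpan v' w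
  InSpan-cong v≐v' (a , e) = a , λ p r → trans (e p r) (∑-cong λ l → *-cong refl (v≐v' l p r))

  IsDim-transfer : ∀ {W W' : Subspace} {d} →
    (∀ w → W w → W' w) → (∀ w → W' w → W w) → IsDim W d → IsDim W' d
  IsDim-transfer to from (v , inW , indep , spans) = v , (λ l → to _ (inW l)) , indep , λ w x → spans w (from w x)

module Graphic {c ℓ : Level} (F : Field c ℓ) (n : ℕ) where
  open Field F hiding (zero; setoid)
  open Spans F n public
  open import Relation.Binary.Reasoning.Setoid (Field.setoid F)
  open import Algebra.Properties.Ring ring using (-1*x≈-x; -0#≈0#; -‿distribʳ-*)
  open import Algebra.Properties.AbelianGroup +-abelianGroup using (⁻¹-anti-homo‿-; ⁻¹-involutive; inverseˡ-unique)
  open import Algebra.Properties.CommutativeSemigroup +-commutativeSemigroup using (interchange; x∙yz≈y∙xz)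

  Vertex : Set
  Vertex = Fin 3 × Fin n

  _≟ᵥ_ : DecidableEquality Vertex
  _≟ᵥ_ = Productₚ.≡-dec _≟_ _≟_

  _≟ₘ_ : DecidableEquality (Maybe Vertex)
  _≟ₘ_ = Maybeₚ.≡-dec _≟ᵥ_

  _at_ : V → Vertex → Carrier
  w at (p , r) = w p r

  mask : Bool → Carrier → Carrier
  mask b x = if b then x else 0#

  mask-cong : ∀ b {x y} → x ≈ y → mask b x ≈ mask b y
  mask-cong true x≈y = x≈y
  mask-cong false _ = refl

  mask-+ : ∀ b x y → mask b (x + y) ≈ mask b x + mask b y
  mask-+ true x y = refl
  mask-+ false x y = sym (+-identityʳ 0#)

  mask-* : ∀ b a x → mask b (a * x) ≈ a * mask b x
  mask-* true a x = refl
  mask-* false a x = sym (zeroʳ a)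

  mask-neg : ∀ b x → mask b (- x) ≈ - mask b x
  mask-neg true x = refl
  mask-neg false x = sym -0#≈0#

  mask-0 : ∀ b → mask b 0# ≈ 0#
  mask-0 true = refl
  mask-0 false = refl

  ind : Bool → Carrier
  ind b = mask b 1#

  *-ind : ∀ a b → a * ind b ≈ mask b a
  *-ind a true = *-identityʳ a
  *-ind a false = zeroʳ a

  ind-injective : ∀ a b → ind a + - ind b ≈ 0# → a ≡ b
  ind-injective true true _ = ≡.refl
  ind-injective false false _ = ≡.refl
  ind-injective true false e = ⊥-elim (0≉1 (sym (trans (sym (trans (+-cong refl -0#≈0#) (+-identityʳ 1#))) e)))
  ind-injective false true e =
    ⊥-elim (0≉1 (sym (trans (sym (⁻¹-involutive 1#)) (trans (-‿cong (trans (sym (+-identityˡ _)) e)) -0#≈0#))))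

  ind-≈0 : ∀ a → ind a ≈ 0# → a ≡ false
  ind-≈0 true e = ⊥-elim (0≉1 (sym e))
  ind-≈0 false _ = ≡.refl

  ∑-pick : ∀ {k} (f : Fin k → Carrier) j → ∑ (λ i → mask (does (i ≟ j)) (f i)) ≈ f j
  ∑-pick {suc k} f zero =
    trans (+-cong refl (∑-0 {f = λ i → mask (does (suc i ≟ zero)) (f (suc i))} λ _ → refl)) (+-identityʳ _)
  ∑-pick {suc k} f (suc j) = trans (+-identityˡ _) (∑-pick (f ∘ suc) j)

  unit : Vertex → V
  unit v p r = ind (does (v ≟ᵥ (p , r)))

  block : Fin 3 → List Vertex
  block p = tabulate (p ,_)

  blocks : List (Fin 3) → List Vertex
  blocks [] = []
  blocks (q ∷ Q) = block q ++ blocks Q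

  ∈-block⁻ : ∀ {p v} → v ∈ block p → proj₁ v ≡ p
  ∈-block⁻ v∈ with ∈-tabulate⁻ v∈
  ... | _ , ≡.refl = ≡.refl

  ∈-blocks⁺ : ∀ {q Q} → q ∈ Q → ∀ r → (q , r) ∈ blocks Q
  ∈-blocks⁺ {Q = q ∷ Q} (here ≡.refl) r = ∈-++⁺ˡ (∈-tabulate⁺ r)
  ∈-blocks⁺ {Q = q ∷ Q} (there q∈Q) r = ∈-++⁺ʳ (block q) (∈-blocks⁺ q∈Q r)

  ∈-blocks⁻ : ∀ Q {v} → v ∈ blocks Q → proj₁ v ∈ Q
  ∈-blocks⁻ (q ∷ Q) v∈ with ∈-++⁻ (block q) v∈
  ... | inj₁ v∈q = here (∈-block⁻ v∈q)
  ... | inj₂ v∈Q = there (∈-blocks⁻ Q v∈Q)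

  block-unique : ∀ p → Unique (block p)
  block-unique p = Uniqueₚ.tabulate⁺ (≡.cong proj₂)

  blocks-unique : ∀ {Q} → Unique Q → Unique (blocks Q)
  blocks-unique [] = []
  blocks-unique {q ∷ Q} (q∉Q ∷ u) = Uniqueₚ.++⁺ (block-unique q) (blocks-unique u)
    λ (v∈q , v∈Q) → All.lookup q∉Q (∈-blocks⁻ Q v∈Q) (≡.sym (∈-block⁻ v∈q))

  length-blocks : ∀ Q → length (blocks Q) ≡ length Q *ℕ n
  length-blocks [] = ≡.refl
  length-blocks (q ∷ Q) = ≡.trans (length-++ (block q)) (≡.cong₂ _+ℕ_ (length-tabulate _) (length-blocks Q))

  vertices : List Vertex
  vertices = blocks (allFin 3)

  ∈-vertices : ∀ v → v ∈ vertices
  ∈-vertices (p , r) = ∈-blocks⁺ (∈-allFin p) r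

  vertices-unique : Unique vertices
  vertices-unique = blocks-unique (Uniqueₚ.allFin⁺ 3)

  Σ[_] : List Vertex → (Vertex → Carrier) → Carrier
  Σ[ [] ] f = 0#
  Σ[ x ∷ xs ] f = f x + Σ[ xs ] f

  Σ-cong : ∀ xs {f g} → (∀ {x} → x ∈ xs → f x ≈ g x) → Σ[ xs ] f ≈ Σ[ xs ] g
  Σ-cong [] _ = refl
  Σ-cong (x ∷ xs) f≈g = +-cong (f≈g (here ≡.refl)) (Σ-cong xs (f≈g ∘ there))

  Σ-0 : ∀ xs {f} → (∀ {x} → x ∈ xs → f x ≈ 0#) → Σ[ xs ] f ≈ 0#
  Σ-0 [] _ = refl
  Σ-0 (x ∷ xs) f≈0 = trans (+-cong (f≈0 (here ≡.refl)) (Σ-0 xs (f≈0 ∘ there))) (+-identityʳ 0#)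

  Σ-+ : ∀ xs f g → Σ[ xs ] (λ x → f x + g x) ≈ Σ[ xs ] f + Σ[ xs ] g
  Σ-+ [] f g = sym (+-identityʳ 0#)
  Σ-+ (x ∷ xs) f g = trans (+-cong refl (Σ-+ xs f g)) (interchange _ _ _ _)

  Σ-* : ∀ xs a f → Σ[ xs ] (λ x → a * f x) ≈ a * Σ[ xs ] f
  Σ-* [] a f = sym (zeroʳ a)
  Σ-* (x ∷ xs) a f = trans (+-cong refl (Σ-* xs a f)) (sym (distribˡ _ _ _))

  Σ-neg : ∀ xs f → Σ[ xs ] (λ x → - f x) ≈ - Σ[ xs ] f
  Σ-neg xs f = trans (Σ-cong xs (λ _ → sym (-1*x≈-x _))) (trans (Σ-* xs _ f) (-1*x≈-x _))

  Σ-filterᵇ : ∀ (P : Vertex → Bool) xs f → Σ[ xs ] f ≈ Σ[ filterᵇ P xs ] f + Σ[ filterᵇ (not ∘ P) xs ] f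
  Σ-filterᵇ P [] f = sym (+-identityʳ 0#)
  Σ-filterᵇ P (x ∷ xs) f with P x
  ... | true = trans (+-cong refl (Σ-filterᵇ P xs f)) (sym (+-assoc _ _ _))
  ... | false = trans (+-cong refl (Σ-filterᵇ P xs f)) (x∙yz≈y∙xz _ _ _)

  Σ-lookup : ∀ xs (f : Vertex → Carrier) → ∑ (λ l → f (lookup xs l)) ≈ Σ[ xs ] f
  Σ-lookup [] f = refl
  Σ-lookup (x ∷ xs) f = +-cong refl (Σ-lookup xs f)

  Σ-pick : ∀ xs v (f : Vertex → Carrier) → Unique xs → v ∈ xs →
    Σ[ xs ] (λ x → mask (does (v ≟ᵥ x)) (f x)) ≈ f v
  Σ-pick (x ∷ xs) v f (x∉xs ∷ _) (here ≡.refl) rewrite dec-true (v ≟ᵥ v) ≡.refl =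
    trans (+-cong refl (Σ-0 xs λ {y} y∈xs → ≡.subst (λ b → mask b (f y) ≈ 0#)
      (≡.sym (dec-false (v ≟ᵥ y) (All.lookup x∉xs y∈xs))) refl)) (+-identityʳ _)
  Σ-pick (x ∷ xs) v f (x∉xs ∷ u) (there v∈xs)
    rewrite dec-false (v ≟ᵥ x) (λ { ≡.refl → All.lookup x∉xs v∈xs ≡.refl }) =
    trans (+-identityˡ _) (Σ-pick xs v f u v∈xs)

  Σ-pick-∉ : ∀ xs v (f : Vertex → Carrier) → v ∉ xs → Σ[ xs ] (λ x → mask (does (v ≟ᵥ x)) (f x)) ≈ 0#
  Σ-pick-∉ xs v f v∉xs = Σ-0 xs λ {y} y∈xs → ≡.subst (λ b → mask b (f y) ≈ 0#)
    (≡.sym (dec-false (v ≟ᵥ y) λ { ≡.refl → v∉xs y∈xs })) refl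

  Φ : (Vertex → Bool) → V → Carrier
  Φ P w = Σ[ vertices ] (λ x → mask (P x) (w at x))

  Φ-resp : ∀ P {u w} → u ≐ w → Φ P u ≈ Φ P w
  Φ-resp P u≐w = Σ-cong vertices λ { {p , r} _ → mask-cong (P (p , r)) (u≐w p r) }

  Φ-⊕ : ∀ P u w → Φ P (u ⊕ w) ≈ Φ P u + Φ P w
  Φ-⊕ P u w = trans (Σ-cong vertices λ { {x} _ → mask-+ (P x) _ _ }) (Σ-+ vertices _ _)

  Φ-⊙ : ∀ P a w → Φ P (a ⊙ w) ≈ a * Φ P w
  Φ-⊙ P a w = trans (Σ-cong vertices λ { {x} _ → mask-* (P x) a _ }) (Σ-* vertices a _)

  Φ-⊖ : ∀ P w → Φ P (⊖ w) ≈ - Φ P w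
  Φ-⊖ P w = trans (Σ-cong vertices λ { {x} _ → mask-neg (P x) _ }) (Σ-neg vertices _)

  Φ-unit : ∀ P v → Φ P (unit v) ≈ ind (P v)
  Φ-unit P v = trans (Σ-cong vertices λ { {x} _ → lemma (P x) (does (v ≟ᵥ x)) })
                     (Σ-pick vertices v (ind ∘ P) vertices-unique (∈-vertices v))
    where
    lemma : ∀ b b' → mask b (ind b') ≈ mask b' (ind b)
    lemma true true = refl
    lemma true false = refl
    lemma false true = refl
    lemma false false = refl

  Φ-Span : ∀ P {gs w} → (∀ {g} → g ∈ gs → Φ P g ≈ 0#) → Span gs w → Φ P w ≈ 0#
  Φ-Span P _ (span[] e) = trans (Φ-resp P e) (Σ-0 vertices λ { {x} _ → mask-0 (P x) })
  Φ-Span P {g ∷ gs} {w} Φgs≈0 (span∷ a u s e) = begin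
    Φ P w                     ≈⟨ Φ-resp P e ⟩
    Φ P (a ⊙ g ⊕ u)           ≈⟨ Φ-⊕ P _ u ⟩
    Φ P (a ⊙ g) + Φ P u       ≈⟨ +-cong (Φ-⊙ P a g) (Φ-Span P (Φgs≈0 ∘ there) s) ⟩
    a * Φ P g + 0#            ≈⟨ +-cong (*-cong refl (Φgs≈0 (here ≡.refl))) refl ⟩
    a * 0# + 0#               ≈⟨ trans (+-identityʳ _) (zeroʳ a) ⟩
    0#                        ∎

  data Edge : Set where
    ground : Vertex → Edge
    arc : Vertex → Vertex → Edge

  edgeVec : Edge → V
  edgeVec (ground v) = unit v
  edgeVec (arc u v) = unit v ⊕ ⊖ unit u

  ⟨_⟩ : List Edge → V → Set (c ⊔ ℓ)
  ⟨ Es ⟩ = Span (map edgeVec Es)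

  record Grounded (Es : List Edge) (x : Vertex) : Set (c ⊔ ℓ) where
    constructor grounded-by
    field span : ⟨ Es ⟩ (unit x)

  record Linked (Es : List Edge) (x y : Vertex) : Set (c ⊔ ℓ) where
    constructor linked-by
    field span : ⟨ Es ⟩ (unit x ⊕ ⊖ unit y)

  Linked-refl : ∀ Es x → Linked Es x x
  Linked-refl Es x = linked-by (Span-resp (Span-𝟘 _) λ p r → sym (-‿inverseʳ _))

  Linked-trans : ∀ {Es x y z} → Linked Es x y → Linked Es y z → Linked Es x z
  Linked-trans (linked-by xy) (linked-by yz) = linked-by (Span-resp (Span-⊕ xy yz) λ p r →
    trans (+-assoc _ _ _) (+-cong refl (trans (sym (+-assoc _ _ _))
      (trans (+-cong (-‿inverseˡ _) refl) (+-identityˡ _)))))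

  Linked-sym : ∀ {Es x y} → Linked Es x y → Linked Es y x
  Linked-sym (linked-by xy) = linked-by (Span-resp (Span-⊖ xy) λ p r → ⁻¹-anti-homo‿- _ _)

  Grounded-Linked : ∀ {Es x y} → Linked Es x y → Grounded Es y → Grounded Es x
  Grounded-Linked (linked-by xy) (grounded-by y₀) = grounded-by (Span-resp (Span-⊕ xy y₀) λ p r →
    trans (+-assoc _ _ _) (trans (+-cong refl (-‿inverseˡ _)) (+-identityʳ _)))

  Linked-∷ : ∀ {E Es x y} → Linked Es x y → Linked (E ∷ Es) x y
  Linked-∷ (linked-by s) = linked-by (Span-there s)

  Grounded-∷ : ∀ {E Es x} → Grounded Es x → Grounded (E ∷ Es) x
  Grounded-∷ (grounded-by s) = grounded-by (Span-there s)

  Linked-arc : ∀ {Es u v} → Linked (arc u v ∷ Es) v u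
  Linked-arc = linked-by Span-here

  Grounded-ground : ∀ {Es v} → Grounded (ground v ∷ Es) v
  Grounded-ground = grounded-by Span-here

  Respects : ∀ {b} {B : Set b} → (Vertex → B) → B → Edge → Set b
  Respects f z (ground v) = f v ≡ z
  Respects f z (arc u v) = f u ≡ f v

  Respects-∘ : ∀ {b b'} {B : Set b} {B' : Set b'} {f : Vertex → B} {z} (g : B → B') {E} →
    Respects f z E → Respects (g ∘ f) (g z) E
  Respects-∘ g {ground v} = ≡.cong g
  Respects-∘ g {arc u v} = ≡.cong g

  Φ-edge : ∀ P {E} → Respects P false E → Φ P (edgeVec E) ≈ 0#
  Φ-edge P {ground v} Pv≡false = trans (Φ-unit P v) (≡.subst (λ b → ind b ≈ 0#) (≡.sym Pv≡false) refl)
  Φ-edge P {arc u v} Pu≡Pv = begin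
    Φ P (unit v ⊕ ⊖ unit u)         ≈⟨ Φ-⊕ P _ _ ⟩
    Φ P (unit v) + Φ P (⊖ unit u)   ≈⟨ +-cong (Φ-unit P v) (trans (Φ-⊖ P _) (-‿cong (Φ-unit P u))) ⟩
    ind (P v) + - ind (P u)         ≡⟨ ≡.cong (λ b → ind (P v) + - ind b) Pu≡Pv ⟩
    ind (P v) + - ind (P v)         ≈⟨ -‿inverseʳ _ ⟩
    0#                              ∎

  Φ-⟨⟩ : ∀ P Es → (∀ {E} → E ∈ Es → Respects P false E) → ∀ {w} → ⟨ Es ⟩ w → Φ P w ≈ 0#
  Φ-⟨⟩ P Es respects = Φ-Span P λ g∈ → let (E , E∈Es , g≡) = ∈-map⁻ edgeVec g∈ in
    ≡.subst (λ g → Φ P g ≈ 0#) (≡.sym g≡) (Φ-edge P (respects E∈Es))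

  nothing≢just : ∀ {x : Vertex} → nothing ≢ just x
  nothing≢just ()

  same-just : ∀ {m : Maybe Vertex} {a b} → m ≡ just a → m ≡ just b → a ≡ b
  same-just ≡.refl ≡.refl = ≡.refl

  -- L v = just r places v in the class of the root r; L v = nothing means v is grounded.
  Label : Set
  Label = Vertex → Maybe Vertex

  relabel : Label → Vertex → Maybe Vertex → Label
  relabel L old new x = if does (L x ≟ₘ just old) then new else L x

  relabel-view : ∀ L old new x →
    (L x ≡ just old × relabel L old new x ≡ new) ⊎ (L x ≢ just old × relabel L old new x ≡ L x)
  relabel-view L old new x with L x ≟ₘ just old
  ... | yes Lx≡old = inj₁ (Lx≡old , ≡.refl)
  ... | no Lx≢old = inj₂ (Lx≢old , ≡.refl)

  relabel-old : ∀ L old new {x} → L x ≡ just old → relabel L old new x ≡ new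
  relabel-old L old new {x} Lx≡old with relabel-view L old new x
  ... | inj₁ (_ , e) = e
  ... | inj₂ (Lx≢old , _) = ⊥-elim (Lx≢old Lx≡old)

  relabel-other : ∀ L old new {x} → L x ≢ just old → relabel L old new x ≡ L x
  relabel-other L old new {x} Lx≢old with relabel-view L old new x
  ... | inj₁ (Lx≡old , _) = ⊥-elim (Lx≢old Lx≡old)
  ... | inj₂ (_ , e) = e

  relabel-respects : ∀ L old new {E} → Respects L nothing E → Respects (relabel L old new) nothing E
  relabel-respects L old new {ground v} Lv≡nothing =
    ≡.trans (relabel-other L old new λ Lv≡old → nothing≢just (≡.trans (≡.sym Lv≡nothing) Lv≡old)) Lv≡nothing
  relabel-respects L old new {arc u v} Lu≡Lv =
    ≡.cong (λ m → if does (m ≟ₘ just old) then new else m) Lu≡Lv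

  record Sound (Es : List Edge) (L : Label) : Set (c ⊔ ℓ) where
    field
      grounded : ∀ {v} → L v ≡ nothing → Grounded Es v
      linked : ∀ {v r} → L v ≡ just r → Linked Es v r
      idempotent : ∀ {v r} → L v ≡ just r → L r ≡ just r
  open Sound public

  Sound-[] : Sound [] just
  Sound-[] = record
    { grounded = λ ()
    ; linked = λ { {v} ≡.refl → Linked-refl [] v }
    ; idempotent = λ { ≡.refl → ≡.refl } }

  Sound-∷ : ∀ {E Es L} → Sound Es L → Sound (E ∷ Es) L
  Sound-∷ S = record
    { grounded = Grounded-∷ ∘ grounded S
    ; linked = Linked-∷ ∘ linked S
    ; idempotent = idempotent S }

  -- The class of old is either grounded or merged into the class of a root r linked to it.
  Target : List Edge → Label → Vertex → Maybe Vertex → Set (c ⊔ ℓ)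
  Target Es L old nothing = Grounded Es old
  Target Es L old (just r) = L r ≡ just r × r ≢ old × Linked Es old r

  Sound-relabel : ∀ {Es L old} new → Sound Es L → Target Es L old new → Sound Es (relabel L old new)
  Sound-relabel {Es} {L} {old} new S target = record
    { grounded = λ {v} → grounded′ new target v
    ; linked = λ {v} → linked′ new target v
    ; idempotent = λ {v} → idempotent′ new target v }
    where
    stays : ∀ new {r} → L r ≡ just r → r ≢ old → relabel L old new r ≡ just r
    stays new {r} Lr≡r r≢old with relabel-view L old new r
    ... | inj₁ (Lr≡old , _) = ⊥-elim (r≢old (Maybeₚ.just-injective (≡.trans (≡.sym Lr≡r) Lr≡old)))
    ... | inj₂ (_ , L′r≡Lr) = ≡.trans L′r≡Lr Lr≡r

    grounded′ : ∀ new → Target Es L old new → ∀ v → relabel L old new v ≡ nothing → Grounded Es v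
    grounded′ new target v L′v≡nothing with relabel-view L old new v
    grounded′ new target v L′v≡nothing | inj₂ (_ , L′v≡Lv) = grounded S (≡.trans (≡.sym L′v≡Lv) L′v≡nothing)
    grounded′ nothing old₀ v _ | inj₁ (Lv≡old , _) = Grounded-Linked (linked S Lv≡old) old₀
    grounded′ (just _) _ v L′v≡nothing | inj₁ (_ , L′v≡new) with () ← ≡.trans (≡.sym L′v≡new) L′v≡nothing

    linked′ : ∀ new → Target Es L old new → ∀ v {r} → relabel L old new v ≡ just r → Linked Es v r
    linked′ new target v L′v≡r with relabel-view L old new v
    linked′ new target v L′v≡r | inj₂ (_ , L′v≡Lv) = linked S (≡.trans (≡.sym L′v≡Lv) L′v≡r)
    linked′ nothing _ v L′v≡r | inj₁ (_ , L′v≡new) with () ← ≡.trans (≡.sym L′v≡new) L′v≡r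
    linked′ (just _) (_ , _ , old~r) v L′v≡r | inj₁ (Lv≡old , L′v≡new)
      with ≡.refl ← same-just L′v≡new L′v≡r = Linked-trans (linked S Lv≡old) old~r

    idempotent′ : ∀ new → Target Es L old new → ∀ v {r} → relabel L old new v ≡ just r → relabel L old new r ≡ just r
    idempotent′ new target v L′v≡r with relabel-view L old new v
    idempotent′ new target v L′v≡r | inj₂ (Lv≢old , L′v≡Lv) =
      stays new (idempotent S Lv≡r) λ { ≡.refl → Lv≢old Lv≡r }
      where Lv≡r = ≡.trans (≡.sym L′v≡Lv) L′v≡r
    idempotent′ nothing _ v L′v≡r | inj₁ (_ , L′v≡new) with () ← ≡.trans (≡.sym L′v≡new) L′v≡r
    idempotent′ (just _) (Lr≡r , r≢old , _) v L′v≡r | inj₁ (_ , L′v≡new)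
      with ≡.refl ← same-just L′v≡new L′v≡r = stays _ Lr≡r r≢old

  step : Edge → Label → Label
  step (ground v) L with L v
  ... | nothing = L
  ... | just r = relabel L r nothing
  step (arc u v) L with L u | L v
  ... | nothing | nothing = L
  ... | nothing | just s = relabel L s nothing
  ... | just r | nothing = relabel L r nothing
  ... | just r | just s = if does (r ≟ᵥ s) then L else relabel L s (just r)

  label : List Edge → Label
  label = foldr step just

  Valid : List Edge → Label → Set (c ⊔ ℓ)
  Valid Es L = Sound Es L × (∀ {E} → E ∈ Es → Respects L nothing E)

  Valid-keep : ∀ {E Es L} → Valid Es L → Respects L nothing E → Valid (E ∷ Es) L
  Valid-keep (S , R) RE = Sound-∷ S , λ { (here ≡.refl) → RE ; (there E∈Es) → R E∈Es }

  Valid-relabel : ∀ {E Es L old} new → Valid Es L → Target (E ∷ Es) L old new →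
    Respects (relabel L old new) nothing E → Valid (E ∷ Es) (relabel L old new)
  Valid-relabel {L = L} {old} new (S , R) target RE =
    Sound-relabel new (Sound-∷ S) target ,
    λ { (here ≡.refl) → RE ; (there E∈Es) → relabel-respects L old new (R E∈Es) }

  label-valid : ∀ Es → Valid Es (label Es)
  label-valid [] = Sound-[] , λ ()
  label-valid (ground v ∷ Es) with label Es v in Lv | label-valid Es
  ... | nothing | V = Valid-keep V Lv
  ... | just r | V@(S , _) = Valid-relabel nothing V
          (Grounded-Linked (Linked-sym (Linked-∷ (linked S Lv))) Grounded-ground)
          (relabel-old (label Es) r nothing Lv)
  label-valid (arc u v ∷ Es) with label Es u in Lu | label Es v in Lv | label-valid Es
  ... | nothing | nothing | V = Valid-keep V (≡.trans Lu (≡.sym Lv))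
  ... | nothing | just s | V@(S , _) = Valid-relabel nothing V
          (Grounded-Linked (Linked-sym (Linked-∷ (linked S Lv)))
            (Grounded-Linked Linked-arc (Grounded-∷ (grounded S Lu))))
          (≡.trans (relabel-other (label Es) s nothing λ Lu≡s → nothing≢just (≡.trans (≡.sym Lu) Lu≡s))
            (≡.trans Lu (≡.sym (relabel-old (label Es) s nothing Lv))))
  ... | just r | nothing | V@(S , _) = Valid-relabel nothing V
          (Grounded-Linked (Linked-sym (Linked-∷ (linked S Lu)))
            (Grounded-Linked (Linked-sym Linked-arc) (Grounded-∷ (grounded S Lv))))
          (≡.trans (relabel-old (label Es) r nothing Lu)
            (≡.sym (≡.trans (relabel-other (label Es) r nothing λ Lv≡r → nothing≢just (≡.trans (≡.sym Lv) Lv≡r)) Lv)))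
  ... | just r | just s | V@(S , _) with r ≟ᵥ s
  ...   | yes ≡.refl = Valid-keep V (≡.trans Lu (≡.sym Lv))
  ...   | no r≢s = Valid-relabel (just r) V
          (idempotent S Lu , r≢s ,
           Linked-trans (Linked-trans (Linked-sym (Linked-∷ (linked S Lv))) Linked-arc) (Linked-∷ (linked S Lu)))
          (≡.trans (relabel-other (label Es) s (just r) λ Lu≡s → r≢s (same-just Lu Lu≡s))
            (≡.trans Lu (≡.sym (relabel-old (label Es) s (just r) Lv))))

  module _ (P : Vertex → Bool) (Es : List Edge) (respects : ∀ {E} → E ∈ Es → Respects P false E) where

    Linked-respects : ∀ {v r} → Linked Es v r → P v ≡ P r
    Linked-respects {v} {r} (linked-by s) = ind-injective (P v) (P r) (begin
      ind (P v) + - ind (P r)        ≈⟨ +-cong (Φ-unit P v) (-‿cong (Φ-unit P r)) ⟨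
      Φ P (unit v) + - Φ P (unit r)  ≈⟨ +-cong refl (Φ-⊖ P _) ⟨
      Φ P (unit v) + Φ P (⊖ unit r)  ≈⟨ Φ-⊕ P _ _ ⟨
      Φ P (unit v ⊕ ⊖ unit r)        ≈⟨ Φ-⟨⟩ P Es respects s ⟩
      0#                             ∎)

    Grounded-respects : ∀ {v} → Grounded Es v → P v ≡ false
    Grounded-respects {v} (grounded-by s) = ind-≈0 (P v) (trans (sym (Φ-unit P v)) (Φ-⟨⟩ P Es respects s))

  module Basis (Es : List Edge) where
    L : Label
    L = label Es

    sound : Sound Es L
    sound = proj₁ (label-valid Es)

    respects : ∀ {E} → E ∈ Es → Respects L nothing E
    respects = proj₂ (label-valid Es)

    isRoot : Vertex → Bool
    isRoot x = does (L x ≟ₘ just x)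

    roots nonRoots : List Vertex
    roots = filterᵇ isRoot vertices
    nonRoots = filterᵇ (not ∘ isRoot) vertices

    nonRoots-unique : Unique nonRoots
    nonRoots-unique = Uniqueₚ.filter⁺ (T? ∘ not ∘ isRoot) vertices-unique

    ∈-nonRoots⁻ : ∀ {x} → x ∈ nonRoots → not (isRoot x) ≡ true
    ∈-nonRoots⁻ = proj₂ ∘ ∈-filterᵇ⁻ (not ∘ isRoot) {xs = vertices}

    root-isRoot : ∀ {x} → L x ≡ just x → isRoot x ≡ true
    root-isRoot {x} = dec-true (L x ≟ₘ just x)

    isRoot-root : ∀ {x} → isRoot x ≡ true → L x ≡ just x
    isRoot-root {x} = does-sound (L x ≟ₘ just x)

    classVec : Maybe Vertex → V
    classVec nothing = 𝟘
    classVec (just r) = unit r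

    basisVec : Vertex → V
    basisVec x = unit x ⊕ ⊖ classVec (L x)

    basisVec-span : ∀ x → ⟨ Es ⟩ (basisVec x)
    basisVec-span x with L x in Lx
    ... | nothing = Span-resp (Grounded.span (grounded sound Lx)) λ p r → sym (trans (+-cong refl -0#≈0#) (+-identityʳ _))
    ... | just r = Linked.span (linked sound Lx)

    classVec-at : ∀ x y → classVec (L x) at y ≈ ind (does (L x ≟ₘ just y))
    classVec-at x y with L x
    ... | nothing = refl
    ... | just r = refl

    classVec-at-nonRoot : ∀ x {y} → not (isRoot y) ≡ true → classVec (L x) at y ≈ 0#
    classVec-at-nonRoot x {y} y∉roots with L x in Lx
    ... | nothing = refl
    ... | just r with r ≟ᵥ y
    ...   | no _ = refl
    ...   | yes ≡.refl with isRoot r in r-root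
    ...     | false = ⊥-elim (true≢false (root-isRoot (idempotent sound Lx)) r-root)

    basisVec-at-nonRoot : ∀ x {y} → not (isRoot y) ≡ true → basisVec x at y ≈ ind (does (x ≟ᵥ y))
    basisVec-at-nonRoot x y∉roots =
      trans (+-cong refl (trans (-‿cong (classVec-at-nonRoot x y∉roots)) -0#≈0#)) (+-identityʳ _)

    b : Fin (length nonRoots) → V
    b l = basisVec (lookup nonRoots l)

    independent : Independent b
    independent a Σab≈0 l = begin
      a l                                                      ≈⟨ ∑-pick a l ⟨
      ∑ (λ l' → mask (does (l' ≟ l)) (a l'))                    ≈⟨ ∑-cong coeff ⟨
      ∑ (λ l' → a l' * b l' (proj₁ y) (proj₂ y))                ≈⟨ Σab≈0 (proj₁ y) (proj₂ y) ⟩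
      0#                                                        ∎
      where
      y = lookup nonRoots l
      coeff : ∀ l' → a l' * b l' (proj₁ y) (proj₂ y) ≈ mask (does (l' ≟ l)) (a l')
      coeff l' = trans (*-cong refl (basisVec-at-nonRoot _ (∈-nonRoots⁻ (∈-lookup l))))
        (trans (*-ind _ _) (≡.subst (λ c → mask c (a l') ≈ mask (does (l' ≟ l)) (a l'))
          (does-⇔ (mk⇔ (≡.cong (lookup nonRoots)) (lookup-injective nonRoots-unique)) (l' ≟ l) (_ ≟ᵥ y)) refl))

    ∈-nonRoots⁺ : ∀ {x} → not (isRoot x) ≡ true → x ∈ nonRoots
    ∈-nonRoots⁺ {x} = ∈-filterᵇ⁺ (not ∘ isRoot) (∈-vertices x)

    ∈-roots⁻ : ∀ {x} → x ∈ roots → L x ≡ just x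
    ∈-roots⁻ = isRoot-root ∘ proj₂ ∘ ∈-filterᵇ⁻ isRoot {xs = vertices}

    module _ (w : V) (w∈ : ⟨ Es ⟩ w) (y : Vertex) where

      inClassOf-y : Vertex → Bool
      inClassOf-y x = does (L x ≟ₘ just y)

      -- Φ vanishes on ⟨ Es ⟩, so the coordinates of w over the class of the root y sum to 0.
      class-sum : isRoot y ≡ true → Σ[ nonRoots ] (λ x → mask (inClassOf-y x) (w at x)) ≈ - (w at y)
      class-sum y-root = inverseˡ-unique _ _ (begin
        Σ[ nonRoots ] (λ x → mask (inClassOf-y x) (w at x)) + w at y
          ≈⟨ +-cong refl (Σ-pick roots y _ roots-unique y∈roots) ⟨
        Σ[ nonRoots ] (λ x → mask (inClassOf-y x) (w at x)) +
          Σ[ roots ] (λ x → mask (does (y ≟ᵥ x)) (w at x))             ≈⟨ +-cong refl (Σ-cong roots on-roots) ⟩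
        Σ[ nonRoots ] (λ x → mask (inClassOf-y x) (w at x)) +
          Σ[ roots ] (λ x → mask (inClassOf-y x) (w at x))             ≈⟨ +-comm _ _ ⟩
        Σ[ roots ] _ + Σ[ nonRoots ] _                                 ≈⟨ Σ-filterᵇ isRoot vertices _ ⟨
        Φ inClassOf-y w
          ≈⟨ Φ-⟨⟩ inClassOf-y Es (Respects-∘ (λ m → does (m ≟ₘ just y)) ∘ respects) w∈ ⟩
        0#                                                             ∎)
        where
        roots-unique = Uniqueₚ.filter⁺ (T? ∘ isRoot) vertices-unique
        y∈roots = ∈-filterᵇ⁺ isRoot (∈-vertices y) y-root
        on-roots : ∀ {x} → x ∈ roots → mask (does (y ≟ᵥ x)) (w at x) ≈ mask (inClassOf-y x) (w at x)
        on-roots {x} x∈roots rewrite ∈-roots⁻ x∈roots =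
          ≡.subst (λ c → mask c (w at x) ≈ mask (does (x ≟ᵥ y)) (w at x))
            (does-⇔ (mk⇔ ≡.sym ≡.sym) (x ≟ᵥ y) (y ≟ᵥ x)) refl

      split : Σ[ nonRoots ] (λ x → w at x * basisVec x at y) ≈
              Σ[ nonRoots ] (λ x → mask (does (y ≟ᵥ x)) (w at x)) + - Σ[ nonRoots ] (λ x → w at x * classVec (L x) at y)
      split = trans (Σ-cong nonRoots λ {x} _ → term x) (trans (Σ-+ nonRoots _ _) (+-cong refl (Σ-neg nonRoots _)))
        where
        term : ∀ x → w at x * basisVec x at y ≈ mask (does (y ≟ᵥ x)) (w at x) + - (w at x * classVec (L x) at y)
        term x = trans (distribˡ _ _ _) (+-cong
          (trans (*-ind _ _) (≡.subst (λ c → mask (does (x ≟ᵥ y)) (w at x) ≈ mask c (w at x))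
            (does-⇔ (mk⇔ ≡.sym ≡.sym) (x ≟ᵥ y) (y ≟ᵥ x)) refl))
          (sym (-‿distribʳ-* _ _)))

      reconstruct : ∑ (λ l → (w at lookup nonRoots l) * (b l at y)) ≈ w at y
      reconstruct with isRoot y in y-root
      ... | false = begin
        _                                    ≈⟨ Σ-lookup nonRoots _ ⟩
        _                                    ≈⟨ split ⟩
        Σ[ nonRoots ] (λ x → mask (does (y ≟ᵥ x)) (w at x)) + - Σ[ nonRoots ] (λ x → w at x * classVec (L x) at y)
          ≈⟨ +-cong (Σ-pick nonRoots y _ nonRoots-unique (∈-nonRoots⁺ y∉roots))
                    (-‿cong (Σ-0 nonRoots λ {x} _ → trans (*-cong refl (classVec-at-nonRoot x y∉roots)) (zeroʳ _))) ⟩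
        w at y + - 0#                        ≈⟨ trans (+-cong refl -0#≈0#) (+-identityʳ _) ⟩
        w at y                               ∎
        where y∉roots = ≡.cong not y-root
      ... | true = begin
        _                                    ≈⟨ Σ-lookup nonRoots _ ⟩
        _                                    ≈⟨ split ⟩
        Σ[ nonRoots ] (λ x → mask (does (y ≟ᵥ x)) (w at x)) + - Σ[ nonRoots ] (λ x → w at x * classVec (L x) at y)
          ≈⟨ +-cong (Σ-pick-∉ nonRoots y _ λ y∈ →
                       true≢false y-root (≡.trans (≡.sym (not-involutive _)) (≡.cong not (∈-nonRoots⁻ y∈))))
                    (-‿cong (trans (Σ-cong nonRoots λ {x} _ → trans (*-cong refl (classVec-at x y)) (*-ind _ _))
                                   (class-sum y-root))) ⟩
        0# + - - (w at y)                    ≈⟨ trans (+-identityˡ _) (⁻¹-involutive _) ⟩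
        w at y                               ∎

    isDim : IsDim ⟨ Es ⟩ (length nonRoots)
    isDim = b , (λ l → basisVec-span _) , independent ,
            λ w w∈ → (λ l → w at lookup nonRoots l) , λ p r → sym (reconstruct w w∈ (p , r))

    length-roots+nonRoots : length roots +ℕ length nonRoots ≡ 3 *ℕ n
    length-roots+nonRoots = ≡.trans (length-filterᵇ-not isRoot vertices) (length-blocks (allFin 3))

    rootOf : Vertex → Vertex
    rootOf x = fromMaybe x (L x)

    -- t ↦ rootOf (σ t) is injective because ℓ′ is constant on the classes of label.
    roots-≥ : ∀ (ℓ′ : Vertex → Maybe Vertex) (ts : List Vertex) (σ : Vertex → Vertex) → Unique ts →
      (∀ {E} → E ∈ Es → Respects ℓ′ nothing E) → (∀ {t} → t ∈ ts → ℓ′ (σ t) ≡ just t) →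
      length ts ≤ length roots
    roots-≥ ℓ′ ts σ ts-unique ℓ′-respects section = length-≤-injection (rootOf ∘ σ) ts-unique injective into-roots
      where
      labelled : Vertex → Vertex → Bool
      labelled t x = does (ℓ′ x ≟ₘ just t)

      labelled-respects : ∀ t {E} → E ∈ Es → Respects (labelled t) false E
      labelled-respects t = Respects-∘ (λ m → does (m ≟ₘ just t)) ∘ ℓ′-respects

      σt-labelled : ∀ {t} → t ∈ ts → labelled t (σ t) ≡ true
      σt-labelled {t} t∈ts = dec-true (ℓ′ (σ t) ≟ₘ just t) (section t∈ts)

      rootOf-σ : ∀ {t} → t ∈ ts → L (σ t) ≡ just (rootOf (σ t)) × ℓ′ (rootOf (σ t)) ≡ just t
      rootOf-σ {t} t∈ts with L (σ t) in Lσt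
      ... | nothing = ⊥-elim (true≢false (σt-labelled t∈ts)
                        (Grounded-respects (labelled t) Es (labelled-respects t) (grounded sound Lσt)))
      ... | just r = ≡.refl , does-sound (ℓ′ r ≟ₘ just t)
                        (≡.trans (≡.sym (Linked-respects (labelled t) Es (labelled-respects t) (linked sound Lσt)))
                                 (σt-labelled t∈ts))

      injective : ∀ {t t′} → t ∈ ts → t′ ∈ ts → rootOf (σ t) ≡ rootOf (σ t′) → t ≡ t′
      injective t∈ts t′∈ts e =
        same-just (proj₂ (rootOf-σ t∈ts)) (≡.trans (≡.cong ℓ′ e) (proj₂ (rootOf-σ t′∈ts)))

      into-roots : ∀ {t} → t ∈ ts → rootOf (σ t) ∈ roots
      into-roots t∈ts = ∈-filterᵇ⁺ isRoot (∈-vertices _) (root-isRoot (idempotent sound (proj₁ (rootOf-σ t∈ts))))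

    nonRoots-≥ : ∀ {ts} → Unique ts → (∀ {t} → t ∈ ts → not (isRoot t) ≡ true) → length ts ≤ length nonRoots
    nonRoots-≥ ts-unique nonRoot = length-≤-⊆ ts-unique (∈-nonRoots⁺ ∘ nonRoot)

    grounded-nonRoot : ∀ {v} → L v ≡ nothing → not (isRoot v) ≡ true
    grounded-nonRoot Lv rewrite Lv = ≡.refl

    arc-nonRoot : ∀ {u v} → arc u v ∈ Es → u ≢ v → isRoot u ≡ true → not (isRoot v) ≡ true
    arc-nonRoot {u} {v} uv∈Es u≢v u-root with isRoot v in v-root
    ... | false = ≡.refl
    ... | true = ⊥-elim (u≢v (same-just (≡.trans (≡.sym (respects uv∈Es)) (isRoot-root u-root)) (isRoot-root v-root)))

module Arrangement {c ℓ g ℓg : Level} (m : ℕ) (R : List (Relator m)) (G : Group g ℓg) (n : ℕ)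
                   (enum : Inverse (Group.setoid G) (≡.setoid (Fin n))) (φ : PresHom G m R) (F : Field c ℓ) where
  open Field F hiding (zero; setoid)
  open Graphic F n
  open Group G using (_∙_; ε; _⁻¹; assoc; identityˡ; identityʳ; inverseˡ; inverseʳ; ∙-cong)
    renaming (Carrier to Gc; _≈_ to _≈G_; refl to G-refl; sym to G-sym; trans to G-trans)
  open Inverse enum using (to; from; to-cong; strictlyInverseˡ; strictlyInverseʳ)
  open import Algebra.Properties.Group G using (∙-cancelˡ; inverseʳ-unique; ⁻¹-anti-homo-∙)
  open import Algebra.Properties.Ring ring using (-0#≈0#)

  A : Elt m → Subspace
  A = arrangement F G n enum φ

  π : Gc → Fin n → Fin n
  π h j = to (h ∙ from j)

  π-injective : ∀ h {j j′} → π h j ≡ π h j′ → j ≡ j′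
  π-injective h {j} {j′} e = ≡.trans (≡.sym (strictlyInverseˡ j)) (≡.trans (to-cong from-j≈) (strictlyInverseˡ j′))
    where
    from-j≈ : from j ≈G from j′
    from-j≈ = ∙-cancelˡ h _ _ (G-trans (G-sym (strictlyInverseʳ _))
                (G-trans (Group.reflexive G (≡.cong from e)) (strictlyInverseʳ _)))

  π-∙ : ∀ h a j → to (h ∙ from (π a j)) ≡ π (h ∙ a) j
  π-∙ h a j = to-cong (G-trans (∙-cong G-refl (strictlyInverseʳ _)) (G-sym (assoc _ _ _)))

  π-cong : ∀ {h h′} j → h ≈G h′ → π h j ≡ π h′ j
  π-cong j h≈h′ = to-cong (∙-cong h≈h′ G-refl)

  π-ε : ∀ j → π ε j ≡ j
  π-ε j = ≡.trans (to-cong (identityˡ _)) (strictlyInverseˡ j)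

  π-inverseʳ : ∀ a y → π a (π (a ⁻¹) y) ≡ y
  π-inverseʳ a y = ≡.trans (π-∙ a (a ⁻¹) y) (≡.trans (π-cong y (inverseʳ a)) (π-ε y))

  gval : Sym m → Gc
  gval bS = ε
  gval eS = ε
  gval (lS a) = letterVal G (PresHom.gens φ) a

  data IsArc : Sym m → Set where
    e-arc : IsArc eS
    l-arc : ∀ a → IsArc (lS a)

  arcs : Fin 3 → Gc → List Edge
  arcs i h = tabulate λ j → arc (i , j) (suc3 i , π h j)

  edgesOf : Elt m → List Edge
  edgesOf (i , bS) = tabulate λ r → ground (i , r)
  edgesOf (i , eS) = arcs i ε
  edgesOf (i , lS a) = arcs i (gval (lS a))

  edgesOf-arc : ∀ i {σ} → IsArc σ → edgesOf (i , σ) ≡ arcs i (gval σ)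
  edgesOf-arc i e-arc = ≡.refl
  edgesOf-arc i (l-arc a) = ≡.refl

  edges : List (Elt m) → List Edge
  edges = concatMap edgesOf

  ∈-edges⁺ : ∀ X {f E} → f ∈ X → E ∈ edgesOf f → E ∈ edges X
  ∈-edges⁺ (f ∷ X) (here ≡.refl) E∈ = ∈-++⁺ˡ E∈
  ∈-edges⁺ (f ∷ X) (there f∈X) E∈ = ∈-++⁺ʳ (edgesOf f) (∈-edges⁺ X f∈X E∈)

  ∈-edges⁻ : ∀ X {E} → E ∈ edges X → ∃ λ f → f ∈ X × E ∈ edgesOf f
  ∈-edges⁻ (f ∷ X) E∈ with ∈-++⁻ (edgesOf f) E∈
  ... | inj₁ E∈f = f , here ≡.refl , E∈f
  ... | inj₂ E∈X = let (f′ , f′∈X , E∈f′) = ∈-edges⁻ X E∈X in f′ , there f′∈X , E∈f′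

  arc∈edges : ∀ X {i σ} → (i , σ) ∈ X → IsArc σ → ∀ j → arc (i , j) (suc3 i , π (gval σ) j) ∈ edges X
  arc∈edges X {i} {σ} f∈X σ-arc j =
    ∈-edges⁺ X f∈X (≡.subst (arc (i , j) (suc3 i , π (gval σ) j) ∈_) (≡.sym (edgesOf-arc i σ-arc)) (∈-tabulate⁺ j))

  private
    diagonal : ∀ (r j : Fin n) → - ind (does (r ≟ j)) ≈ 0# + - ind (does (j ≟ r))
    diagonal r j rewrite eqFin-sym r j = sym (+-identityˡ _)

    offDiagonal : ∀ x → x ≈ x + - 0#
    offDiagonal x = sym (trans (+-cong refl -0#≈0#) (+-identityʳ x))

    zero-block : 0# ≈ 0# + - 0#
    zero-block = offDiagonal 0#

  blockCol-arc : ∀ i h j → blockCol i (regRep F G n enum h) j ≐ edgeVec (arc (i , j) (suc3 i , π h j))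
  blockCol-arc zero h j zero r = diagonal r j
  blockCol-arc zero h j (suc zero) r = offDiagonal _
  blockCol-arc zero h j (suc (suc zero)) r = zero-block
  blockCol-arc (suc zero) h j zero r = zero-block
  blockCol-arc (suc zero) h j (suc zero) r = diagonal r j
  blockCol-arc (suc zero) h j (suc (suc zero)) r = offDiagonal _
  blockCol-arc (suc (suc zero)) h j zero r = offDiagonal _
  blockCol-arc (suc (suc zero)) h j (suc zero) r = zero-block
  blockCol-arc (suc (suc zero)) h j (suc (suc zero)) r = diagonal r j

  unit-sum : ∀ (a : Fin n → Carrier) i p r → ∑ (λ l → a l * unit (i , l) p r) ≈ mask (does (p ≟ i)) (a r)
  unit-sum a i p r with p ≟ i
  ... | yes ≡.refl = trans (∑-cong λ l → trans (*-ind _ _) (≡.subst (λ c → mask c (a l) ≈ mask (does (l ≟ r)) (a l))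
                                (does-⇔ (mk⇔ (≡.cong (p ,_)) (≡.cong proj₂)) (l ≟ r) ((p , l) ≟ᵥ (p , r))) refl))
                           (∑-pick a r)
  ... | no p≢i = ∑-0 λ l → trans (*-cong refl (≡.subst (λ c → ind c ≈ 0#)
                              (≡.sym (dec-false ((i , l) ≟ᵥ (p , r)) λ e → p≢i (≡.sym (≡.cong proj₁ e)))) refl))
                          (zeroʳ _)

  private
    ⟨tabulate⟩ : ∀ {k} (h : Fin k → Edge) {w} → ⟨ tabulate h ⟩ w ≡ Span (tabulate (edgeVec ∘ h)) w
    ⟨tabulate⟩ h {w} = ≡.cong (λ gs → Span gs w) (map-tabulate h edgeVec)

    arcs-InSpan : ∀ i h {w} → ColSpan (blockCol i (regRep F G n enum h)) w → ⟨ arcs i h ⟩ w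
    arcs-InSpan i h w∈ = ≡.subst id (≡.sym (⟨tabulate⟩ _)) (InSpan⇒Span _ (InSpan-cong (blockCol-arc i h) w∈))

    InSpan-arcs : ∀ i h {w} → ⟨ arcs i h ⟩ w → ColSpan (blockCol i (regRep F G n enum h)) w
    InSpan-arcs i h w∈ =
      InSpan-cong (λ j p r → sym (blockCol-arc i h j p r)) (Span⇒InSpan _ (≡.subst id (⟨tabulate⟩ _) w∈))

  A⇒⟨⟩ : ∀ f {w} → A f w → ⟨ edgesOf f ⟩ w
  A⇒⟨⟩ (i , bS) (u , e) = ≡.subst id (≡.sym (⟨tabulate⟩ _))
    (InSpan⇒Span (λ r → unit (i , r)) (u , λ p r → trans (e p r) (sym (unit-sum u i p r))))
  A⇒⟨⟩ (i , eS) = arcs-InSpan i ε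
  A⇒⟨⟩ (i , lS a) = arcs-InSpan i (gval (lS a))

  ⟨⟩⇒A : ∀ f {w} → ⟨ edgesOf f ⟩ w → A f w
  ⟨⟩⇒A (i , bS) w∈ with Span⇒InSpan (λ r → unit (i , r)) (≡.subst id (⟨tabulate⟩ _) w∈)
  ... | u , e = u , λ p r → trans (e p r) (unit-sum u i p r)
  ⟨⟩⇒A (i , eS) = InSpan-arcs i ε
  ⟨⟩⇒A (i , lS a) = InSpan-arcs i (gval (lS a))

  ⟨edges⟩ : ∀ f X {w} → ⟨ edges (f ∷ X) ⟩ w ≡ Span (map edgeVec (edgesOf f) ++ map edgeVec (edges X)) w
  ⟨edges⟩ f X {w} = ≡.cong (λ gs → Span gs w) (map-++ edgeVec (edgesOf f) (edges X))

  SumSp⇒⟨⟩ : ∀ X {w} → SumSp (map A X) w → ⟨ edges X ⟩ w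
  SumSp⇒⟨⟩ [] (lift w≐0) = span[] w≐0
  SumSp⇒⟨⟩ (f ∷ X) (u , v , u∈ , v∈ , w≐) = ≡.subst id (≡.sym (⟨edges⟩ f X))
    (Span-resp (Span-⊕ (Span-++ˡ _ (A⇒⟨⟩ f u∈)) (Span-++ʳ _ (SumSp⇒⟨⟩ X v∈))) λ p r → sym (w≐ p r))

  ⟨⟩⇒SumSp : ∀ X {w} → ⟨ edges X ⟩ w → SumSp (map A X) w
  ⟨⟩⇒SumSp [] (span[] w≐0) = lift w≐0
  ⟨⟩⇒SumSp (f ∷ X) w∈ with Span-++⁻ (map edgeVec (edgesOf f)) (≡.subst id (⟨edges⟩ f X) w∈)
  ... | u , v , u∈ , v∈ , w≐ = u , v , ⟨⟩⇒A f u∈ , ⟨⟩⇒SumSp X v∈ , w≐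

  dim : List (Elt m) → ℕ
  dim X = length (Basis.nonRoots (edges X))

  dim-isDim : ∀ X → IsDim (SumSp (map A X)) (dim X)
  dim-isDim X = IsDim-transfer (λ _ → ⟨⟩⇒SumSp X) (λ _ → SumSp⇒⟨⟩ X) (Basis.isDim (edges X))

  A-isDim : ∀ f → IsDim (A f) (dim (f ∷ []))
  A-isDim f = IsDim-transfer
    (λ _ w∈ → ⟨⟩⇒A f (≡.subst (λ Es → ⟨ Es ⟩ _) (++-identityʳ (edgesOf f)) (SumSp⇒⟨⟩ (f ∷ []) w∈)))
    (λ _ w∈ → ⟨⟩⇒SumSp (f ∷ [])
                 (≡.subst (λ Es → ⟨ Es ⟩ _) (≡.sym (++-identityʳ (edgesOf f))) (A⇒⟨⟩ f w∈)))
    (dim-isDim (f ∷ []))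

  BlockPotential : Set g
  BlockPotential = Fin 3 → Maybe (Fin 3 × Gc)

  potentialLabel : BlockPotential → Vertex → Maybe Vertex
  potentialLabel ψ (p , x) with ψ p
  ... | nothing = nothing
  ... | just (q , h) = just (q , π h x)

  data ArcFits (ψ : BlockPotential) (i : Fin 3) (a : Gc) : Set (g ⊔ ℓg) where
    grounded-arc : ψ i ≡ nothing → ψ (suc3 i) ≡ nothing → ArcFits ψ i a
    shifted-arc : ∀ {q h h′} → ψ i ≡ just (q , h) → ψ (suc3 i) ≡ just (q , h′) → h′ ∙ a ≈G h → ArcFits ψ i a

  data Fits (ψ : BlockPotential) : Elt m → Set (g ⊔ ℓg) where
    ground-fits : ∀ {p} → ψ p ≡ nothing → Fits ψ (p , bS)
    arc-fits : ∀ {p σ} → IsArc σ → ArcFits ψ p (gval σ) → Fits ψ (p , σ)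

  Fits-respects : ∀ ψ {f E} → Fits ψ f → E ∈ edgesOf f → Respects (potentialLabel ψ) nothing E
  Fits-respects ψ {p , bS} (ground-fits ψp) E∈ with ∈-tabulate⁻ E∈
  ... | r , ≡.refl rewrite ψp = ≡.refl
  Fits-respects ψ {p , σ} (arc-fits σ-arc fits) E∈
    with ∈-tabulate⁻ (≡.subst (_ ∈_) (edgesOf-arc p σ-arc) E∈)
  ... | j , ≡.refl with fits
  ...   | grounded-arc ψp ψp′ rewrite ψp | ψp′ = ≡.refl
  ...   | shifted-arc {q} ψp ψp′ h′a≈h rewrite ψp | ψp′ =
          ≡.cong (λ x → just (q , x)) (≡.sym (≡.trans (π-∙ _ _ j) (π-cong j h′a≈h)))

  roots-≥-potential : ∀ X ψ Q → Unique Q → (∀ {q} → q ∈ Q → ∃ λ h → ψ q ≡ just (q , h)) →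
    (∀ {f} → f ∈ X → Fits ψ f) → length Q *ℕ n ≤ length (Basis.roots (edges X))
  roots-≥-potential X ψ Q Q-unique selfLabelled fits = ≡.subst (_≤ _) (length-blocks Q)
    (Basis.roots-≥ (edges X) (potentialLabel ψ) (blocks Q) unshift (blocks-unique Q-unique) respects section)
    where
    unshift : Vertex → Vertex
    unshift (q , x) with ψ q
    ... | nothing = q , x
    ... | just (_ , h) = q , π (h ⁻¹) x

    section : ∀ {t} → t ∈ blocks Q → potentialLabel ψ (unshift t) ≡ just t
    section {q , x} t∈ with selfLabelled (∈-blocks⁻ Q t∈)
    ... | h , ψq rewrite ψq | ψq = ≡.cong (λ y → just (q , y)) (π-inverseʳ h x)

    respects : ∀ {E} → E ∈ edges X → Respects (potentialLabel ψ) nothing E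
    respects E∈ = let (f , f∈X , E∈f) = ∈-edges⁻ X E∈ in Fits-respects ψ (fits f∈X) E∈f

  L : List (Elt m) → Label
  L X = Basis.L (edges X)

  GroundedBlock : List (Elt m) → Fin 3 → Set
  GroundedBlock X q = ∀ r → L X (q , r) ≡ nothing

  bS-grounds : ∀ X {k} → (k , bS) ∈ X → GroundedBlock X k
  bS-grounds X f∈X r = Basis.respects (edges X) (∈-edges⁺ X f∈X (∈-tabulate⁺ r))

  arc-grounds-forward : ∀ X {i σ} → (i , σ) ∈ X → IsArc σ → GroundedBlock X i → GroundedBlock X (suc3 i)
  arc-grounds-forward X {i} {σ} f∈X σ-arc grounded y =
    ≡.subst (λ z → L X (suc3 i , z) ≡ nothing) (π-inverseʳ (gval σ) y)
      (≡.trans (≡.sym (Basis.respects (edges X) (arc∈edges X f∈X σ-arc (π (gval σ ⁻¹) y)))) (grounded _))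

  arc-grounds-backward : ∀ X {i σ} → (i , σ) ∈ X → IsArc σ → GroundedBlock X (suc3 i) → GroundedBlock X i
  arc-grounds-backward X f∈X σ-arc grounded j =
    ≡.trans (Basis.respects (edges X) (arc∈edges X f∈X σ-arc j)) (grounded _)

  dim-≥-grounded : ∀ X Q → Unique Q → (∀ {q} → q ∈ Q → GroundedBlock X q) → length Q *ℕ n ≤ dim X
  dim-≥-grounded X Q Q-unique grounded = ≡.subst (_≤ dim X) (length-blocks Q)
    (Basis.nonRoots-≥ (edges X) (blocks-unique Q-unique)
      λ {t} t∈ → Basis.grounded-nonRoot (edges X) (grounded (∈-blocks⁻ Q t∈) (proj₂ t)))

  module _ (X : List (Elt m)) {i σ} (f∈X : (i , σ) ∈ X) (σ-arc : IsArc σ) where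
    open Basis (edges X) using (isRoot)

    -- Of the two ends of the arc (i , j) → (i + 1 , π (gval σ) j), one is not a root.
    arcEndpoint : Fin n → Vertex
    arcEndpoint j = if isRoot (i , j) then (suc3 i , π (gval σ) j) else (i , j)

    arcEndpoint-block : ∀ j → proj₁ (arcEndpoint j) ≡ i ⊎ proj₁ (arcEndpoint j) ≡ suc3 i
    arcEndpoint-block j with isRoot (i , j)
    ... | true = inj₂ ≡.refl
    ... | false = inj₁ ≡.refl

    arcEndpoint-injective : ∀ {j j′} → arcEndpoint j ≡ arcEndpoint j′ → j ≡ j′
    arcEndpoint-injective {j} {j′} e with isRoot (i , j) | isRoot (i , j′)
    ... | true | true = π-injective (gval σ) (≡.cong proj₂ e)
    ... | false | false = ≡.cong proj₂ e
    ... | true | false = ⊥-elim (suc3-≢ i (≡.sym (≡.cong proj₁ e)))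
    ... | false | true = ⊥-elim (suc3-≢ i (≡.cong proj₁ e))

    arcEndpoint-nonRoot : ∀ j → not (isRoot (arcEndpoint j)) ≡ true
    arcEndpoint-nonRoot j with isRoot (i , j) in root
    ... | false = ≡.cong not root
    ... | true = Basis.arc-nonRoot (edges X) (arc∈edges X f∈X σ-arc j) (λ e → suc3-≢ i (≡.cong proj₁ e)) root

  dim-≥-arc : ∀ X Q → Unique Q → (∀ {q} → q ∈ Q → GroundedBlock X q) →
    ∀ {i σ} → (i , σ) ∈ X → IsArc σ → i ∉ Q → suc3 i ∉ Q → suc (length Q) *ℕ n ≤ dim X
  dim-≥-arc X Q Q-unique grounded f∈X σ-arc i∉Q i′∉Q = ≡.subst (_≤ dim X) length-ts
    (Basis.nonRoots-≥ (edges X) ts-unique λ t∈ts → [ grounded-nonRoot , endpoint-nonRoot ]′ (∈-++⁻ (blocks Q) t∈ts))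
    where
    endpoints = map (arcEndpoint X f∈X σ-arc) (allFin n)

    length-ts : length (blocks Q ++ endpoints) ≡ suc (length Q) *ℕ n
    length-ts = ≡.trans (length-++ (blocks Q)) (≡.trans
      (≡.cong₂ _+ℕ_ (length-blocks Q) (≡.trans (length-map _ (allFin n)) (length-tabulate _))) (ℕₚ.+-comm _ n))

    ∉Q : ∀ {t} → t ∈ endpoints → proj₁ t ∉ Q
    ∉Q t∈ with ∈-map⁻ _ t∈
    ... | j , _ , ≡.refl with arcEndpoint-block X f∈X σ-arc j
    ...   | inj₁ e = ≡.subst (_∉ Q) (≡.sym e) i∉Q
    ...   | inj₂ e = ≡.subst (_∉ Q) (≡.sym e) i′∉Q

    ts-unique : Unique (blocks Q ++ endpoints)
    ts-unique = Uniqueₚ.++⁺ (blocks-unique Q-unique)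
      (Uniqueₚ.map⁺ (arcEndpoint-injective X f∈X σ-arc) (Uniqueₚ.allFin⁺ n))
      λ (t∈Q , t∈E) → ∉Q t∈E (∈-blocks⁻ Q t∈Q)

    grounded-nonRoot : ∀ {t} → t ∈ blocks Q → not (Basis.isRoot (edges X) t) ≡ true
    grounded-nonRoot {t} t∈ = Basis.grounded-nonRoot (edges X) (grounded (∈-blocks⁻ Q t∈) (proj₂ t))

    endpoint-nonRoot : ∀ {t} → t ∈ endpoints → not (Basis.isRoot (edges X) t) ≡ true
    endpoint-nonRoot t∈ with ∈-map⁻ _ t∈
    ... | j , _ , ≡.refl = arcEndpoint-nonRoot X f∈X σ-arc j

  #roots : List (Elt m) → ℕ
  #roots X = length (Basis.roots (edges X))

  roots-≥-single : ∀ X ψ q h → ψ q ≡ just (q , h) → (∀ {f} → f ∈ X → Fits ψ f) → n ≤ #roots X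
  roots-≥-single X ψ q h ψq fits = ≡.subst (_≤ #roots X) (ℕₚ.+-identityʳ n)
    (roots-≥-potential X ψ (q ∷ []) (All.[] ∷ []) (λ { (here ≡.refl) → h , ψq }) fits)

  Avoids : List (Fin 3) → Elt m → Set
  Avoids Q (p , bS) = p ∉ Q
  Avoids Q (p , eS) = p ∉ Q × suc3 p ∉ Q
  Avoids Q (p , lS _) = p ∉ Q × suc3 p ∉ Q

  Avoids-arc : ∀ {Q p σ} → IsArc σ → p ∉ Q → suc3 p ∉ Q → Avoids Q (p , σ)
  Avoids-arc e-arc p∉Q p′∉Q = p∉Q , p′∉Q
  Avoids-arc (l-arc _) p∉Q p′∉Q = p∉Q , p′∉Q

  roots-≥-untouched : ∀ X Q → Unique Q → (∀ {f} → f ∈ X → Avoids Q f) → length Q *ℕ n ≤ #roots X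
  roots-≥-untouched X Q Q-unique avoids = roots-≥-potential X ψ Q Q-unique (λ q∈Q → ε , ψ-in q∈Q) fits
    where
    ψ : BlockPotential
    ψ p = if does (p ∈? Q) then just (p , ε) else nothing

    ψ-in : ∀ {q} → q ∈ Q → ψ q ≡ just (q , ε)
    ψ-in {q} q∈Q rewrite dec-true (q ∈? Q) q∈Q = ≡.refl

    ψ-out : ∀ {p} → p ∉ Q → ψ p ≡ nothing
    ψ-out {p} p∉Q rewrite dec-false (p ∈? Q) p∉Q = ≡.refl

    fits : ∀ {f} → f ∈ X → Fits ψ f
    fits {p , bS} f∈X = ground-fits (ψ-out (avoids f∈X))
    fits {p , eS} f∈X = arc-fits e-arc (grounded-arc (ψ-out (proj₁ (avoids f∈X))) (ψ-out (proj₂ (avoids f∈X))))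
    fits {p , lS a} f∈X = arc-fits (l-arc a) (grounded-arc (ψ-out (proj₁ (avoids f∈X))) (ψ-out (proj₂ (avoids f∈X))))

  roots-≥-untouched₁ : ∀ X q → (∀ {f} → f ∈ X → Avoids (q ∷ []) f) → n ≤ #roots X
  roots-≥-untouched₁ X q avoids =
    ≡.subst (_≤ #roots X) (ℕₚ.+-identityʳ n) (roots-≥-untouched X (q ∷ []) (All.[] ∷ []) avoids)

  arcPotential : Fin 3 → Sym m → Maybe (Fin 3 × Gc) → BlockPotential
  arcPotential i σ z = rot i (just (i , ε)) (just (i , gval σ ⁻¹)) z

  arcPotential-fits : ∀ i {σ} z → IsArc σ → Fits (arcPotential i σ z) (i , σ)
  arcPotential-fits i z σ-arc = arc-fits σ-arc (shifted-arc (rot-0 i _ _ z) (rot-1 i _ _ z) (inverseˡ _))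

  roots-≥-twisted : ∀ X i {σ} → IsArc σ → (∀ {f} → f ∈ X → f ≡ (i , σ) ⊎ f ≡ (suc3 (suc3 i) , bS)) →
    n ≤ #roots X
  roots-≥-twisted X i {σ} σ-arc covered = roots-≥-single X ψ i ε (rot-0 i _ _ _) fits
    where
    ψ = arcPotential i σ nothing
    fits : ∀ {f} → f ∈ X → Fits ψ f
    fits f∈X with covered f∈X
    ... | inj₁ ≡.refl = arcPotential-fits i _ σ-arc
    ... | inj₂ ≡.refl = ground-fits (rot-2 i _ _ _)

  roots-≥-arc : ∀ i {σ} → IsArc σ → 2 *ℕ n ≤ #roots ((i , σ) ∷ [])
  roots-≥-arc i {σ} σ-arc = roots-≥-potential ((i , σ) ∷ []) ψ (i ∷ suc3 (suc3 i) ∷ [])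
    ((suc3²-≢ i All.∷ All.[]) ∷ All.[] ∷ [])
    (λ { (here ≡.refl) → ε , rot-0 i _ _ _ ; (there (here ≡.refl)) → ε , rot-2 i _ _ _ })
    (λ { (here ≡.refl) → arcPotential-fits i _ σ-arc })
    where ψ = arcPotential i σ (just (suc3 (suc3 i) , ε))

  roots-≥-triangle : ∀ X i (x y z : Gc) → y ∙ x ∙ z ≈G ε →
    (∀ {p σ} → (p , σ) ∈ X → IsArc σ × gval σ ≈G rot i x y z p) → n ≤ #roots X
  roots-≥-triangle X i x y z cycle labelled = roots-≥-single X ψ i ε (rot-0 i _ _ _) fits
    where
    ψ : BlockPotential
    ψ = rot i (just (i , ε)) (just (i , x ⁻¹)) (just (i , x ⁻¹ ∙ y ⁻¹))

    shift : ∀ p {a} → a ≈G rot i x y z p → ArcFits ψ p a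
    shift p a≈ with rotation-cases i p
    ... | inj₁ ≡.refl = shifted-arc (rot-0 i _ _ _) (rot-1 i _ _ _)
      (G-trans (∙-cong G-refl (G-trans a≈ (Group.reflexive G (rot-0 i x y z)))) (inverseˡ _))
    ... | inj₂ (inj₁ ≡.refl) = shifted-arc (rot-1 i _ _ _) (rot-2 i _ _ _)
      (G-trans (∙-cong G-refl (G-trans a≈ (Group.reflexive G (rot-1 i x y z))))
        (G-trans (assoc _ _ _) (G-trans (∙-cong G-refl (inverseˡ _)) (identityʳ _))))
    ... | inj₂ (inj₂ ≡.refl) = shifted-arc (rot-2 i _ _ _) (≡.trans (≡.cong ψ (suc3³ i)) (rot-0 i _ _ _))
      (G-trans (identityˡ _) (G-trans a≈ (G-trans (Group.reflexive G (rot-2 i x y z))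
        (G-trans (inverseʳ-unique _ _ cycle) (⁻¹-anti-homo-∙ _ _)))))

    fits : ∀ {f} → f ∈ X → Fits ψ f
    fits {p , σ} f∈X = arc-fits (proj₁ (labelled f∈X)) (shift p (proj₂ (labelled f∈X)))

  roots-≥-path : ∀ X i {σ τ} → IsArc σ → IsArc τ → (∀ {f} → f ∈ X → f ≡ (i , σ) ⊎ f ≡ (suc3 i , τ)) →
    n ≤ #roots X
  roots-≥-path X i {σ} {τ} σ-arc τ-arc onPath =
    roots-≥-triangle X i (gval σ) (gval τ) (gval σ ⁻¹ ∙ gval τ ⁻¹)
      (G-trans (∙-cong G-refl (G-sym (⁻¹-anti-homo-∙ _ _))) (inverseʳ _)) labelled
    where
    labelled : ∀ {p ρ} → (p , ρ) ∈ X → IsArc ρ × gval ρ ≈G rot i (gval σ) (gval τ) _ p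
    labelled f∈X with onPath f∈X
    ... | inj₁ ≡.refl = σ-arc , Group.reflexive G (≡.sym (rot-0 i _ _ _))
    ... | inj₂ ≡.refl = τ-arc , Group.reflexive G (≡.sym (rot-1 i _ _ _))

  roots-≥-L1 : ∀ X i → (∀ {f} → f ∈ X → onLine f (L1 i) ≡ true) → n ≤ #roots X
  roots-≥-L1 X i onL = roots-≥-untouched₁ X (suc3 (suc3 i)) avoids
    where
    ∉i+2 : ∀ {p} → p ≡ i ⊎ p ≡ suc3 i → p ∉ suc3 (suc3 i) ∷ []
    ∉i+2 (inj₁ ≡.refl) (here e) = suc3²-≢ i e
    ∉i+2 (inj₂ ≡.refl) (here e) = suc3-≢ (suc3 i) e

    onArc : ∀ {p} → eqFin p i ≡ true → p ∉ suc3 (suc3 i) ∷ [] × suc3 p ∉ suc3 (suc3 i) ∷ []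
    onArc {p} p≡i with ≡.refl ← eqFin-sound {i = p} {j = i} p≡i = ∉i+2 (inj₁ ≡.refl) , ∉i+2 (inj₂ ≡.refl)

    avoids : ∀ {f} → f ∈ X → Avoids (suc3 (suc3 i) ∷ []) f
    avoids {p , bS} f∈X with ∨-true (onL f∈X)
    ... | inj₁ p≡i = ∉i+2 (inj₁ (eqFin-sound p≡i))
    ... | inj₂ p≡i+1 = ∉i+2 (inj₂ (eqFin-sound p≡i+1))
    avoids {p , eS} f∈X = onArc (onL f∈X)
    avoids {p , lS _} f∈X = onArc (onL f∈X)

  roots-≥-L2 : ∀ X {s i j k} → distinct3 i j k ≡ true → (∀ {f} → f ∈ X → onLine f (L2 s i j k) ≡ true) →
    n ≤ #roots X
  roots-≥-L2 X {s} {i} {j} {k} distinct onL with distinct3-sound distinct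
  ... | i≢j , i≢k , j≢k with rotation-cases i j | rotation-cases i k
  ...   | inj₁ j≡i | _ = ⊥-elim (i≢j (≡.sym j≡i))
  ...   | _ | inj₁ k≡i = ⊥-elim (i≢k (≡.sym k≡i))
  ...   | inj₂ (inj₁ ≡.refl) | inj₂ (inj₁ k≡j) = ⊥-elim (j≢k (≡.sym k≡j))
  ...   | inj₂ (inj₂ ≡.refl) | inj₂ (inj₂ k≡j) = ⊥-elim (j≢k (≡.sym k≡j))
  ...   | inj₂ (inj₁ ≡.refl) | inj₂ (inj₂ ≡.refl) =
          roots-≥-triangle X i s′ (s′ ⁻¹) ε (G-trans (identityʳ _) (inverseˡ _)) labelled
    where
    s′ = gval (lS (gen s))
    labelled : ∀ {p σ} → (p , σ) ∈ X → IsArc σ × gval σ ≈G rot i s′ (s′ ⁻¹) ε p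
    labelled {p} {σ} f∈X with onL2 (p , σ) (onL f∈X)
    ... | inj₁ ≡.refl = l-arc _ , Group.reflexive G (≡.sym (rot-0 i _ _ _))
    ... | inj₂ (inj₁ ≡.refl) = l-arc _ , Group.reflexive G (≡.sym (rot-1 i _ _ _))
    ... | inj₂ (inj₂ ≡.refl) = e-arc , Group.reflexive G (≡.sym (rot-2 i _ _ _))
  ...   | inj₂ (inj₂ ≡.refl) | inj₂ (inj₁ ≡.refl) =
          roots-≥-triangle X i s′ ε (s′ ⁻¹) (G-trans (∙-cong (identityˡ _) G-refl) (inverseʳ _)) labelled
    where
    s′ = gval (lS (gen s))
    labelled : ∀ {p σ} → (p , σ) ∈ X → IsArc σ × gval σ ≈G rot i s′ ε (s′ ⁻¹) p
    labelled {p} {σ} f∈X with onL2 (p , σ) (onL f∈X)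
    ... | inj₁ ≡.refl = l-arc _ , Group.reflexive G (≡.sym (rot-0 i _ _ _))
    ... | inj₂ (inj₁ ≡.refl) = l-arc _ , Group.reflexive G (≡.sym (rot-2 i _ _ _))
    ... | inj₂ (inj₂ ≡.refl) = e-arc , Group.reflexive G (≡.sym (rot-1 i _ _ _))

  roots-≥-L3 : ∀ X → (∀ {f} → f ∈ X → onLine f L3 ≡ true) → n ≤ #roots X
  roots-≥-L3 X onL = roots-≥-triangle X zero ε ε ε (G-trans (identityʳ _) (identityʳ _)) labelled
    where
    rot-ε : ∀ p → rot zero ε ε ε p ≡ ε
    rot-ε zero = ≡.refl
    rot-ε (suc zero) = ≡.refl
    rot-ε (suc (suc zero)) = ≡.refl

    labelled : ∀ {p σ} → (p , σ) ∈ X → IsArc σ × gval σ ≈G rot zero ε ε ε p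
    labelled {p} {σ} f∈X with ≡.refl ← onL3 (p , σ) (onL f∈X) = e-arc , Group.reflexive G (≡.sym (rot-ε p))

  -- The relator xyz is what closes the cycle of the line {x⁽²⁾, y⁽¹⁾, z⁽³⁾}.
  roots-≥-L4 : ∀ X {x y z} → (x , y , z) ∈ R → (∀ {f} → f ∈ X → onLine f (L4 (x , y , z)) ≡ true) →
    n ≤ #roots X
  roots-≥-L4 X {x} {y} {z} xyz∈R onL =
    roots-≥-triangle X zero (gval (lS y)) (gval (lS x)) (gval (lS z)) (PresHom.respects φ xyz∈R) labelled
    where
    labelled : ∀ {p σ} → (p , σ) ∈ X → IsArc σ × gval σ ≈G rot zero (gval (lS y)) (gval (lS x)) (gval (lS z)) p
    labelled {p} {σ} f∈X with onL4 (p , σ) (onL f∈X)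
    ... | inj₁ ≡.refl = l-arc _ , G-refl
    ... | inj₂ (inj₁ ≡.refl) = l-arc _ , G-refl
    ... | inj₂ (inj₂ ≡.refl) = l-arc _ , G-refl

  roots-≥-line : ∀ X {L} → L ∈ allLines m R → (∀ {f} → f ∈ X → onLine f L ≡ true) → n ≤ #roots X
  roots-≥-line X {L1 i} _ = roots-≥-L1 X i
  roots-≥-line X {L2 _ _ _ _} L∈ = roots-≥-L2 X (allLines-valid L∈)
  roots-≥-line X {L3} _ = roots-≥-L3 X
  roots-≥-line X {L4 _} L∈ = roots-≥-L4 X (allLines-valid L∈)

  dim+roots : ∀ X → dim X +ℕ #roots X ≡ 3 *ℕ n
  dim+roots X = ≡.trans (ℕₚ.+-comm (dim X) _) (Basis.length-roots+nonRoots (edges X))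

  dim-≤ : ∀ X k r → k *ℕ n ≤ #roots X → k +ℕ r ≡ 3 → dim X ≤ n *ℕ r
  dim-≤ X k r roots≥ k+r≡3 =
    ≡.subst (dim X ≤_) (ℕₚ.*-comm r n) (ℕₚ.+-cancelʳ-≤ (k *ℕ n) (dim X) (r *ℕ n) (begin
    dim X +ℕ k *ℕ n    ≤⟨ ℕₚ.+-monoʳ-≤ (dim X) roots≥ ⟩
    dim X +ℕ #roots X  ≡⟨ dim+roots X ⟩
    3 *ℕ n             ≡⟨ ≡.cong (_*ℕ n) (≡.trans (≡.sym k+r≡3) (ℕₚ.+-comm k r)) ⟩
    (r +ℕ k) *ℕ n      ≡⟨ ℕₚ.*-distribʳ-+ n r k ⟩
    r *ℕ n +ℕ k *ℕ n   ∎))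
    where open ℕₚ.≤-Reasoning

  dim-≤-2 : ∀ X → n ≤ #roots X → dim X ≤ n *ℕ 2
  dim-≤-2 X roots≥ = dim-≤ X 1 2 (≡.subst (_≤ #roots X) (≡.sym (ℕₚ.+-identityʳ n)) roots≥) ≡.refl

  dim-≤-3 : ∀ X → dim X ≤ n *ℕ 3
  dim-≤-3 X = dim-≤ X 0 3 z≤n ≡.refl

  #nonBasis : List (Elt m) → ℕ
  #nonBasis X = length (filterᵇ (not ∘ isB) X)

  Bounds : List (Elt m) → ℕ → Set
  Bounds X r = dim X ≤ n *ℕ r × (#nonBasis X ≤ 1 → dim X ≡ n *ℕ r)

  Bounds-intro : ∀ X r → dim X ≤ n *ℕ r → (#nonBasis X ≤ 1 → r *ℕ n ≤ dim X) → Bounds X r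
  Bounds-intro X r ub lb = ub , λ ≤1 → ℕₚ.≤-antisym ub (≡.subst (_≤ dim X) (ℕₚ.*-comm r n) (lb ≤1))

  exact : ∀ X r → dim X ≤ n *ℕ r → r *ℕ n ≤ dim X → Bounds X r
  exact X r ub lb = Bounds-intro X r ub λ _ → lb

  ∉-[_] : ∀ {p q : Fin 3} → p ≢ q → p ∉ q ∷ []
  ∉-[ p≢q ] (here p≡q) = p≢q p≡q

  unique₂ : ∀ {p q : Fin 3} → p ≢ q → Unique (p ∷ q ∷ [])
  unique₂ p≢q = (p≢q All.∷ All.[]) ∷ All.[] ∷ []

  pair-cases : ∀ {f g h : Elt m} → h ∈ f ∷ g ∷ [] → h ≡ f ⊎ h ≡ g
  pair-cases (here e) = inj₁ e
  pair-cases (there (here e)) = inj₂ e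

  pair-cases′ : ∀ {f g h : Elt m} → h ∈ f ∷ g ∷ [] → h ≡ g ⊎ h ≡ f
  pair-cases′ (here e) = inj₂ e
  pair-cases′ (there (here e)) = inj₁ e

  bounds-[] : Bounds [] 0
  bounds-[] = exact [] 0 (dim-≤ [] 3 0 (roots-≥-untouched [] (allFin 3) (Uniqueₚ.allFin⁺ 3) (λ ())) ≡.refl) z≤n

  bounds-arc : ∀ i {σ} → IsArc σ → Bounds ((i , σ) ∷ []) 1
  bounds-arc i {σ} σ-arc = exact X 1 (dim-≤ X 2 1 (roots-≥-arc i σ-arc) ≡.refl)
    (dim-≥-arc X [] [] (λ ()) (here ≡.refl) σ-arc (λ ()) (λ ()))
    where X = (i , σ) ∷ []

  bounds-single : ∀ f → Bounds (f ∷ []) 1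
  bounds-single (k , bS) = exact X 1
    (dim-≤ X 2 1 (roots-≥-untouched X (suc3 k ∷ suc3 (suc3 k) ∷ []) (unique₂ (suc3-≢ (suc3 k)))
                   λ { (here ≡.refl) → λ { (here e) → suc3-≢ k e ; (there (here e)) → suc3²-≢ k e } }) ≡.refl)
    (dim-≥-grounded X (k ∷ []) (All.[] ∷ []) λ { (here ≡.refl) → bS-grounds X (here ≡.refl) })
    where X = (k , bS) ∷ []
  bounds-single (i , eS) = bounds-arc i e-arc
  bounds-single (i , lS a) = bounds-arc i (l-arc a)

  bounds-bS-bS : ∀ {k l} → k ≢ l → Bounds ((k , bS) ∷ (l , bS) ∷ []) 2
  bounds-bS-bS {k} {l} k≢l = exact X 2 (dim-≤-2 X upper)
    (dim-≥-grounded X (k ∷ l ∷ []) (unique₂ k≢l)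
      λ { (here ≡.refl) → bS-grounds X (here ≡.refl) ; (there (here ≡.refl)) → bS-grounds X (there (here ≡.refl)) })
    where
    X = (k , bS) ∷ (l , bS) ∷ []
    upper : n ≤ #roots X
    upper with rotation-cases k l
    ... | inj₁ ≡.refl = ⊥-elim (k≢l ≡.refl)
    ... | inj₂ (inj₁ ≡.refl) = roots-≥-untouched₁ X (suc3 (suc3 k))
            λ { (here ≡.refl) → ∉-[ suc3²-≢ k ] ; (there (here ≡.refl)) → ∉-[ suc3-≢ (suc3 k) ] }
    ... | inj₂ (inj₂ ≡.refl) = roots-≥-untouched₁ X (suc3 k)
            λ { (here ≡.refl) → ∉-[ suc3-≢ k ]
              ; (there (here ≡.refl)) → ∉-[ (λ e → suc3-≢ (suc3 k) (≡.sym e)) ] }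

  bounds-bS-arc : ∀ X k i {σ} → IsArc σ → (k , bS) ∈ X → (i , σ) ∈ X →
    (∀ {f} → f ∈ X → f ≡ (k , bS) ⊎ f ≡ (i , σ)) → Bounds X 2
  bounds-bS-arc X k i {σ} σ-arc k∈X i∈X covered with rotation-cases i k
  ... | inj₁ ≡.refl = exact X 2 (dim-≤-2 X (roots-≥-untouched₁ X (suc3 (suc3 i)) avoids))
          (dim-≥-grounded X (i ∷ suc3 i ∷ []) (unique₂ (suc3-≢ i)) λ
            { (here ≡.refl) → bS-grounds X k∈X
            ; (there (here ≡.refl)) → arc-grounds-forward X i∈X σ-arc (bS-grounds X k∈X) })
    where
    avoids : ∀ {f} → f ∈ X → Avoids (suc3 (suc3 i) ∷ []) f
    avoids f∈X with covered f∈X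
    ... | inj₁ ≡.refl = ∉-[ suc3²-≢ i ]
    ... | inj₂ ≡.refl = Avoids-arc σ-arc ∉-[ suc3²-≢ i ] ∉-[ suc3-≢ (suc3 i) ]
  ... | inj₂ (inj₁ ≡.refl) = exact X 2 (dim-≤-2 X (roots-≥-untouched₁ X (suc3 (suc3 i)) avoids))
          (dim-≥-grounded X (i ∷ suc3 i ∷ []) (unique₂ (suc3-≢ i)) λ
            { (here ≡.refl) → arc-grounds-backward X i∈X σ-arc (bS-grounds X k∈X)
            ; (there (here ≡.refl)) → bS-grounds X k∈X })
    where
    avoids : ∀ {f} → f ∈ X → Avoids (suc3 (suc3 i) ∷ []) f
    avoids f∈X with covered f∈X
    ... | inj₁ ≡.refl = ∉-[ suc3-≢ (suc3 i) ]
    ... | inj₂ ≡.refl = Avoids-arc σ-arc ∉-[ suc3²-≢ i ] ∉-[ suc3-≢ (suc3 i) ]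
  ... | inj₂ (inj₂ ≡.refl) = exact X 2
          (dim-≤-2 X (roots-≥-twisted X i σ-arc covered′))
          (dim-≥-arc X (suc3 (suc3 i) ∷ []) (All.[] ∷ []) (λ { (here ≡.refl) → bS-grounds X k∈X })
            i∈X σ-arc ∉-[ suc3²-≢ i ] ∉-[ suc3-≢ (suc3 i) ])
    where
    covered′ : ∀ {f} → f ∈ X → f ≡ (i , σ) ⊎ f ≡ (suc3 (suc3 i) , bS)
    covered′ f∈X with covered f∈X
    ... | inj₁ e = inj₂ e
    ... | inj₂ e = inj₁ e

  dim-≤-arcs : ∀ X i j {σ τ} → IsArc σ → IsArc τ → (∀ {f} → f ∈ X → f ≡ (i , σ) ⊎ f ≡ (j , τ)) →
    dim X ≤ n *ℕ 2
  dim-≤-arcs X i j {σ} {τ} σ-arc τ-arc covered with rotation-cases i j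
  ... | inj₁ ≡.refl = dim-≤-2 X (roots-≥-untouched₁ X (suc3 (suc3 i)) avoids)
    where
    avoids : ∀ {f} → f ∈ X → Avoids (suc3 (suc3 i) ∷ []) f
    avoids f∈X with covered f∈X
    ... | inj₁ ≡.refl = Avoids-arc σ-arc ∉-[ suc3²-≢ i ] ∉-[ suc3-≢ (suc3 i) ]
    ... | inj₂ ≡.refl = Avoids-arc τ-arc ∉-[ suc3²-≢ i ] ∉-[ suc3-≢ (suc3 i) ]
  ... | inj₂ (inj₁ ≡.refl) = dim-≤-2 X (roots-≥-path X i σ-arc τ-arc covered)
  ... | inj₂ (inj₂ ≡.refl) = dim-≤-2 X (roots-≥-path X (suc3 (suc3 i)) τ-arc σ-arc covered′)
    where
    covered′ : ∀ {f} → f ∈ X → f ≡ (suc3 (suc3 i) , τ) ⊎ f ≡ (suc3 (suc3 (suc3 i)) , σ)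
    covered′ f∈X rewrite suc3³ i with covered f∈X
    ... | inj₁ e = inj₂ e
    ... | inj₂ e = inj₁ e

  bounds-pair : ∀ f g → f ≢ g → Bounds (f ∷ g ∷ []) 2
  bounds-pair (k , bS) (l , bS) f≢g = bounds-bS-bS λ { ≡.refl → f≢g ≡.refl }
  bounds-pair (k , bS) (i , eS) _ = bounds-bS-arc _ k i e-arc (here ≡.refl) (there (here ≡.refl)) pair-cases
  bounds-pair (k , bS) (i , lS a) _ = bounds-bS-arc _ k i (l-arc a) (here ≡.refl) (there (here ≡.refl)) pair-cases
  bounds-pair (i , eS) (k , bS) _ = bounds-bS-arc _ k i e-arc (there (here ≡.refl)) (here ≡.refl) pair-cases′
  bounds-pair (i , lS a) (k , bS) _ = bounds-bS-arc _ k i (l-arc a) (there (here ≡.refl)) (here ≡.refl) pair-cases′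
  bounds-pair (i , eS) (j , eS) _ = dim-≤-arcs _ i j e-arc e-arc pair-cases , λ { (s≤s ()) }
  bounds-pair (i , eS) (j , lS b) _ = dim-≤-arcs _ i j e-arc (l-arc b) pair-cases , λ { (s≤s ()) }
  bounds-pair (i , lS a) (j , eS) _ = dim-≤-arcs _ i j (l-arc a) e-arc pair-cases , λ { (s≤s ()) }
  bounds-pair (i , lS a) (j , lS b) _ = dim-≤-arcs _ i j (l-arc a) (l-arc b) pair-cases , λ { (s≤s ()) }

  classify : ∀ (f : Elt m) → (∃ λ k → f ≡ (k , bS)) ⊎ IsArc (proj₂ f)
  classify (k , bS) = inj₁ (k , ≡.refl)
  classify (k , eS) = inj₂ e-arc
  classify (k , lS a) = inj₂ (l-arc a)

  arc-nonBasis : ∀ {p σ} → IsArc σ → not (isB (p , σ)) ≡ true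
  arc-nonBasis e-arc = ≡.refl
  arc-nonBasis (l-arc _) = ≡.refl

  arc-unique : ∀ X → #nonBasis X ≤ 1 → ∀ {t t′} → t ∈ X → t′ ∈ X → IsArc (proj₂ t) → IsArc (proj₂ t′) →
    t ≡ t′
  arc-unique X ≤1 t∈X t′∈X t-arc t′-arc = length≤1-≡ ≤1
    (∈-filterᵇ⁺ (not ∘ isB) t∈X (arc-nonBasis t-arc)) (∈-filterᵇ⁺ (not ∘ isB) t′∈X (arc-nonBasis t′-arc))

  block-≢ : ∀ {k l : Fin 3} → (Elt m ∋ (k , bS)) ≢ (l , bS) → k ≢ l
  block-≢ ne ≡.refl = ne ≡.refl

  two-grounds : ∀ (f g h : Elt m) rest → Unique (f ∷ g ∷ h ∷ rest) → #nonBasis (f ∷ g ∷ h ∷ rest) ≤ 1 →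
    ∃₂ λ (k l : Fin 3) → k ≢ l × (k , bS) ∈ f ∷ g ∷ h ∷ rest × (l , bS) ∈ f ∷ g ∷ h ∷ rest
  two-grounds f g h rest ((f≢g All.∷ f≢h All.∷ _) ∷ (g≢h All.∷ _) ∷ _) ≤1
    with classify f | classify g | classify h
  ... | inj₁ (k , ≡.refl) | inj₁ (l , ≡.refl) | _ = k , l , block-≢ f≢g , here ≡.refl , there (here ≡.refl)
  ... | inj₁ (k , ≡.refl) | inj₂ _ | inj₁ (l , ≡.refl) =
          k , l , block-≢ f≢h , here ≡.refl , there (there (here ≡.refl))
  ... | inj₂ _ | inj₁ (k , ≡.refl) | inj₁ (l , ≡.refl) =
          k , l , block-≢ g≢h , there (here ≡.refl) , there (there (here ≡.refl))
  ... | inj₂ f-arc | inj₂ g-arc | _ =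
          ⊥-elim (f≢g (arc-unique (f ∷ g ∷ h ∷ rest) ≤1 (here ≡.refl) (there (here ≡.refl)) f-arc g-arc))
  ... | inj₂ f-arc | inj₁ _ | inj₂ h-arc =
          ⊥-elim (f≢h (arc-unique (f ∷ g ∷ h ∷ rest) ≤1 (here ≡.refl) (there (there (here ≡.refl))) f-arc h-arc))
  ... | inj₁ _ | inj₂ g-arc | inj₂ h-arc =
          ⊥-elim (g≢h (arc-unique (f ∷ g ∷ h ∷ rest) ≤1 (there (here ≡.refl)) (there (there (here ≡.refl))) g-arc h-arc))

  Collinear : List (Elt m) → Bool
  Collinear X = any (λ L → all (λ f → onLine f L) X) (allLines m R)

  collinear⁻ : ∀ X → Collinear X ≡ true → ∃ λ L → L ∈ allLines m R × (∀ {f} → f ∈ X → onLine f L ≡ true)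
  collinear⁻ X e with find (any⁻ (λ L → all (λ f → onLine f L) X) (allLines m R) (Equivalence.from T-≡ e))
  ... | L , L∈ , allOn = L , L∈ , λ f∈X → Equivalence.to T-≡ (All.lookup (all⁺ (λ f → onLine f L) X allOn) f∈X)

  collinear⁺ : ∀ X {L} → L ∈ allLines m R → (∀ {f} → f ∈ X → onLine f L ≡ true) → Collinear X ≡ true
  collinear⁺ X {L} L∈ onL = Equivalence.to T-≡ (any⁺ (λ L → all (λ f → onLine f L) X)
    (lose L∈ (all⁻ (λ f → onLine f L) (All.tabulate (Equivalence.from T-≡ ∘ onL)))))

  ground? : ∀ p (f : Elt m) → Dec ((p , bS) ≡ f)
  ground? p (q , bS) = map′ (≡.cong (_, bS)) (≡.cong proj₁) (p ≟ q)
  ground? p (q , eS) = no λ ()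
  ground? p (q , lS _) = no λ ()

  onL1-arc : ∀ {p i σ} → IsArc σ → onLine (p , σ) (L1 i) ≡ eqFin p i
  onL1-arc e-arc = ≡.refl
  onL1-arc (l-arc _) = ≡.refl

  arc-among-three : ∀ f g h rest → Unique (f ∷ g ∷ h ∷ rest) → ∀ {p} → (p , bS) ∉ f ∷ g ∷ h ∷ rest →
    ∃₂ λ i σ → (i , σ) ∈ f ∷ g ∷ h ∷ rest × IsArc σ
  arc-among-three f g h rest ((a≢b All.∷ a≢c All.∷ _) ∷ (b≢c All.∷ _) ∷ _) {p} p∉X
    with classify f | classify g | classify h
  ... | inj₂ f-arc | _ | _ = _ , _ , here ≡.refl , f-arc
  ... | _ | inj₂ g-arc | _ = _ , _ , there (here ≡.refl) , g-arc
  ... | _ | _ | inj₂ h-arc = _ , _ , there (there (here ≡.refl)) , h-arc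
  ... | inj₁ (a , ≡.refl) | inj₁ (b , ≡.refl) | inj₁ (c , ≡.refl)
    with distinct-cases (block-≢ a≢b) (block-≢ a≢c) (block-≢ b≢c) p
  ...   | inj₁ ≡.refl = ⊥-elim (p∉X (here ≡.refl))
  ...   | inj₂ (inj₁ ≡.refl) = ⊥-elim (p∉X (there (here ≡.refl)))
  ...   | inj₂ (inj₂ ≡.refl) = ⊥-elim (p∉X (there (there (here ≡.refl))))

  -- The two grounded blocks ground the third one along the arc element, unless X lies on L1.
  all-grounded : ∀ f g h rest → Unique (f ∷ g ∷ h ∷ rest) → #nonBasis (f ∷ g ∷ h ∷ rest) ≤ 1 →
    Collinear (f ∷ g ∷ h ∷ rest) ≡ false → ∀ p → GroundedBlock (f ∷ g ∷ h ∷ rest) p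
  all-grounded f g h rest u ≤1 ¬collinear p with any? (ground? p) (f ∷ g ∷ h ∷ rest)
  ... | yes p∈X = bS-grounds _ p∈X
  ... | no p∉X with two-grounds f g h rest u ≤1
  ...   | k , l , k≢l , k∈X , l∈X = via-arc (arc-among-three f g h rest u p∉X)
    where
    X = f ∷ g ∷ h ∷ rest

    others : ∀ q → q ≢ p → GroundedBlock X q
    others q q≢p with distinct-cases k≢l (λ { ≡.refl → p∉X k∈X }) (λ { ≡.refl → p∉X l∈X }) q
    ... | inj₁ ≡.refl = bS-grounds X k∈X
    ... | inj₂ (inj₁ ≡.refl) = bS-grounds X l∈X
    ... | inj₂ (inj₂ q≡p) = ⊥-elim (q≢p q≡p)

    via-arc : (∃₂ λ i σ → (i , σ) ∈ X × IsArc σ) → GroundedBlock X p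
    via-arc (i , σ , t∈X , σ-arc) with rotation-cases i p
    ... | inj₁ ≡.refl = arc-grounds-backward X t∈X σ-arc (others (suc3 i) (λ e → suc3-≢ i (≡.sym e)))
    ... | inj₂ (inj₁ ≡.refl) = arc-grounds-forward X t∈X σ-arc (others i (suc3-≢ i))
    ... | inj₂ (inj₂ ≡.refl) =
          ⊥-elim (true≢false (collinear⁺ X (∈-++⁺ˡ (∈-map⁺ L1 (∈-allFin i))) onL1) ¬collinear)
      where
      onArc : ∀ {q τ} → (q , τ) ∈ X → IsArc τ → onLine (q , τ) (L1 i) ≡ true
      onArc f∈X τ-arc with ≡.refl ← ≡.cong proj₁ (arc-unique X ≤1 f∈X t∈X τ-arc σ-arc) =
        ≡.trans (onL1-arc τ-arc) (eqFin-refl i)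

      onL1 : ∀ {f′} → f′ ∈ X → onLine f′ (L1 i) ≡ true
      onL1 {q , bS} f∈X with rotation-cases i q
      ... | inj₁ ≡.refl rewrite eqFin-refl i = ≡.refl
      ... | inj₂ (inj₁ ≡.refl) rewrite eqFin-refl (suc3 i) = ∨-zeroʳ _
      ... | inj₂ (inj₂ ≡.refl) = ⊥-elim (p∉X f∈X)
      onL1 {q , eS} f∈X = onArc f∈X e-arc
      onL1 {q , lS a} f∈X = onArc f∈X (l-arc a)

  bounds-collinear : ∀ f g h rest → Unique (f ∷ g ∷ h ∷ rest) → Collinear (f ∷ g ∷ h ∷ rest) ≡ true →
    Bounds (f ∷ g ∷ h ∷ rest) 2
  bounds-collinear f g h rest u collinear =
    let X = f ∷ g ∷ h ∷ rest
        (L , L∈ , onL) = collinear⁻ X collinear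
    in Bounds-intro X 2 (dim-≤-2 X (roots-≥-line X L∈ onL)) λ ≤1 →
         let (k , l , k≢l , k∈X , l∈X) = two-grounds f g h rest u ≤1 in
         dim-≥-grounded X (k ∷ l ∷ []) (unique₂ k≢l)
           λ { (here ≡.refl) → bS-grounds X k∈X ; (there (here ≡.refl)) → bS-grounds X l∈X }

  bounds-not-collinear : ∀ f g h rest → Unique (f ∷ g ∷ h ∷ rest) → Collinear (f ∷ g ∷ h ∷ rest) ≡ false →
    Bounds (f ∷ g ∷ h ∷ rest) 3
  bounds-not-collinear f g h rest u ¬collinear = Bounds-intro X 3 (dim-≤-3 X) λ ≤1 →
    dim-≥-grounded X (allFin 3) (Uniqueₚ.allFin⁺ 3) λ {q} _ → all-grounded f g h rest u ≤1 ¬collinear q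
    where X = f ∷ g ∷ h ∷ rest

  bounds : ∀ X → Unique X → Bounds X (rankN m R X)
  bounds [] _ = bounds-[]
  bounds (f ∷ []) _ = bounds-single f
  bounds (f ∷ g ∷ []) ((f≢g All.∷ _) ∷ _) = bounds-pair f g f≢g
  bounds (f ∷ g ∷ h ∷ rest) u
    with any (λ L → all (λ f′ → onLine f′ L) (f ∷ g ∷ h ∷ rest)) (allLines m R) in collinear
  ... | true = bounds-collinear f g h rest u collinear
  ... | false = bounds-not-collinear f g h rest u collinear

  A-isDim-n : ∀ f → IsDim (A f) n
  A-isDim-n f = ≡.subst (IsDim (A f))
    (≡.trans (proj₂ (bounds-single f) (length-filter (T? ∘ not ∘ isB) (f ∷ []))) (ℕₚ.*-identityʳ n))
    (A-isDim f)

proposition4p4 : ∀ {c ℓ g ℓg : Level} (m : ℕ) (R : List (Relator m))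
    (G : Group g ℓg) (n : ℕ) (enum : Inverse (Group.setoid G) (setoid (Fin n)))
    (φ : PresHom G m R) (F : Field c ℓ) →
    LinAlg.WeakRep F n (rankN m R) isB (arrangement F G n enum φ)
proposition4p4 m R G n enum φ F = A-isDim-n , λ X X-unique → dim X , dim-isDim X , bounds X X-unique
  where open Arrangement m R G n enum φ F
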